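{- For every graph $G$ with at least one edge, \[\operatorname{td}_2(G)\le\operatorname{rtd}_2(G)\le 2\operatorname{td}_2(G)-2.\]
   Context: Rooted $2$-treedepth: $\operatorname{rtd}_2(G)=0$ if $G$ is the null graph; $=1$ if $G$ has one vertex; otherwise the minimum of $\max\{\operatorname{rtd}_2(A),\operatorname{rtd}_2(B-V(A))+|V(A)\cap V(B)|\}$ over all pairs $(A,B)$ of subgraphs with $A\cup B=G$, $E(A\cap B)=\emptyset$, $|V(A)\cap V(B)|\le 1$, $V(A)\ne\emptyset$, $V(B)\setminus V(A)\ne\emptyset$. A block of a graph is a maximal connected subgraph without a cut vertex. $2$-treedepth: $\operatorname{td}_2(X)=0$ if $X$ is null; $\operatorname{td}_2(X)=1+\min_{v}\operatorname{td}_2(X-v)$ if $X$ consists of one block; $\operatorname{td}_2(X)=\max_i\operatorname{td}_2(B_i)$ if $X$ consists of blocks $B_1,\dots,B_k$ with $k>1$. -}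

module Defs where

open import Data.Nat using (ℕ; zero; suc; _+_; _≤_)
open import Data.Bool using (Bool; true; false; _∧_; _∨_; not; if_then_else_)
open import Data.Fin using (Fin; _≟_)
open import Data.List using (List; map; allFin)
open import Data.Nat.ListAction using (sum)
open import Data.Product using (Σ; _×_; ∃)
open import Relation.Nullary using (¬_)
open import Relation.Nullary.Decidable using (⌊_⌋)
open import Relation.Binary.PropositionalEquality using (_≡_)

-- A finite simple graph whose vertex set is a subset of the universe Fin n.
-- V x = true  iff x is a vertex; E x y = true iff xy is an edge.
record Graph (n : ℕ) : Set where
  constructor graph
  field
    V : Fin n → Bool
    E : Fin n → Fin n → Bool
open Graph public

record WF {n : ℕ} (G : Graph n) : Set where
  field
    ends   : ∀ x y → E G x y ≡ true → V G x ≡ true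
    sym    : ∀ x y → E G x y ≡ E G y x
    irrefl : ∀ x → E G x x ≡ false
open WF public

count : {n : ℕ} → (Fin n → Bool) → ℕ
count {n} P = sum (map (λ x → if P x then 1 else 0) (allFin n))

IsNull : {n : ℕ} → Graph n → Set
IsNull G = ∀ x → V G x ≡ false

HasEdge : {n : ℕ} → Graph n → Set
HasEdge G = ∃ λ x → ∃ λ y → E G x y ≡ true

record Subgraph {n : ℕ} (H G : Graph n) : Set where
  field
    wf   : WF H
    subV : ∀ x → V H x ≡ true → V G x ≡ true
    subE : ∀ x y → E H x y ≡ true → E G x y ≡ true
open Subgraph public

_≅_ : {n : ℕ} → Graph n → Graph n → Set
H ≅ G = (∀ x → V H x ≡ V G x) × (∀ x y → E H x y ≡ E G x y)

delete : {n : ℕ} → Graph n → Fin n → Graph n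
delete G v = graph (λ x → V G x ∧ not ⌊ x ≟ v ⌋)
                   (λ x y → E G x y ∧ (not ⌊ x ≟ v ⌋ ∧ not ⌊ y ≟ v ⌋))

deleteSet : {n : ℕ} → Graph n → (Fin n → Bool) → Graph n
deleteSet B S = graph (λ x → V B x ∧ not (S x))
                      (λ x y → E B x y ∧ (not (S x) ∧ not (S y)))

data Walk {n : ℕ} (H : Graph n) : Fin n → Fin n → Set where
  here : ∀ {x} → V H x ≡ true → Walk H x x
  step : ∀ {x y z} → E H x y ≡ true → Walk H y z → Walk H x z

-- every two vertices of H are joined by a walk in H (vacuous for the null graph)
AllLinked : {n : ℕ} → Graph n → Set
AllLinked H = ∀ x y → V H x ≡ true → V H y ≡ true → Walk H x y

Connected : {n : ℕ} → Graph n → Set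
Connected H = (∃ λ x → V H x ≡ true) × AllLinked H

-- H is connected and has no cut vertex
-- (v is a cut vertex of the connected graph H iff H - v is disconnected)
NoCutConnected : {n : ℕ} → Graph n → Set
NoCutConnected H = Connected H × (∀ v → V H v ≡ true → AllLinked (delete H v))

record IsBlock {n : ℕ} (B G : Graph n) : Set where
  field
    sub     : Subgraph B G
    nocut   : NoCutConnected B
    maximal : ∀ H → Subgraph H G → NoCutConnected H → Subgraph B H → H ≅ B
open IsBlock public

OneBlock : {n : ℕ} → Graph n → Set
OneBlock X = IsBlock X X

-- TD2≤ X k  :  td₂(X) ≤ k   (following the recursive definition of td₂)
data TD2≤ {n : ℕ} : Graph n → ℕ → Set where
  null  : ∀ {X k} → IsNull X → TD2≤ X k
  one   : ∀ {X k} → OneBlock X → (v : Fin n) → V X v ≡ true →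
          TD2≤ (delete X v) k → TD2≤ X (suc k)
  many  : ∀ {X k} → ¬ IsNull X → ¬ OneBlock X →
          (∀ B → IsBlock B X → TD2≤ B k) → TD2≤ X k

-- RTD2≤ X k  :  rtd₂(X) ≤ k   (following the recursive definition of rtd₂)
data RTD2≤ {n : ℕ} : Graph n → ℕ → Set where
  null   : ∀ {X k} → IsNull X → RTD2≤ X k
  single : ∀ {X k} → count (V X) ≡ 1 → RTD2≤ X (suc k)
  split  : ∀ {X k} → 2 ≤ count (V X) →
           (A B : Graph n) → Subgraph A X → Subgraph B X →
           (∀ x → (V A x ∨ V B x) ≡ V X x) →
           (∀ x y → (E A x y ∨ E B x y) ≡ E X x y) →
           (∀ x y → (E A x y ∧ E B x y) ≡ false) →
           count (λ x → V A x ∧ V B x) ≤ 1 →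
           (∃ λ x → V A x ≡ true) →
           (∃ λ x → (V B x ∧ not (V A x)) ≡ true) →
           RTD2≤ A k →
           (m : ℕ) → RTD2≤ (deleteSet B (V A)) m →
           m + count (λ x → V A x ∧ V B x) ≤ k →
           RTD2≤ X k

-- In a separation (A, B) with |V(A) ∩ V(B)| ≤ 1, a 2-connected subgraph of G lies in A,
-- or in B − V(A), or becomes a subgraph of B − V(A) once the shared vertex is removed; so an rtd₂
-- decomposition bounds td₂ of every block of G, block by block.
--
-- A disconnected graph splits into a
-- component and the rest.  A connected graph has a leaf block Z attached at a vertex u (found by
-- descending through cut vertices); split G into G − (Z − u) and Z, sharing u.  Since Z is a block,
-- td₂(Z − w) ≤ j + 1 for some w, which gives rtd₂(Z − u) ≤ 2j + 1: directly when w = u, and otherwise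
-- by peeling w off Z − u and using induction on Z − u − w ⊆ Z − w.

module Submission where

open import Defs
open import Data.Bool using (Bool; true; false; _∧_; _∨_; not; if_then_else_) renaming (_≟_ to _≟ᵇ_)
open import Data.Bool.Properties using (∧-comm; ∧-zeroʳ)
open import Data.Empty using (⊥; ⊥-elim)
open import Data.Fin using (Fin; zero; suc; _≟_)
open import Data.Fin.Properties using (any?; all?; suc-injective)
open import Data.List using (map; allFin)
open import Data.List.Properties using (map-tabulate)
open import Data.Nat using (ℕ; zero; suc; _+_; _*_; _∸_; _≤_; _<_; z≤n; s≤s; _<?_; _≤?_)
open import Data.Nat.Properties
  using (≤-refl; ≤-reflexive; ≤-trans; ≤-antisym; <-irrefl; ≤-pred; ≮⇒≥; ≰⇒>;
         +-mono-≤; +-monoˡ-≤; +-monoʳ-≤; +-cancelˡ-≤; +-cancelʳ-≤; *-identityʳ; n≤1+n; m≤m+n; +-comm;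
         m≤n+m; +-identityʳ; +-suc)
open import Data.Nat.ListAction using (sum)
open import Data.Product using (_×_; ∃; _,_; proj₁; proj₂)
open import Data.Sum using (_⊎_; inj₁; inj₂)
open import Function using (_∘_; id)
open import Relation.Binary.PropositionalEquality
  using (_≡_; refl; trans; cong; cong₂; subst; subst₂) renaming (sym to ≡-sym)
open import Relation.Nullary using (¬_; Dec; yes; no)
open import Relation.Nullary.Decidable using (⌊_⌋)

private
  variable
    n : ℕ

∧-intro : ∀ {a b} → a ≡ true → b ≡ true → a ∧ b ≡ true
∧-intro refl refl = refl

∧-elimˡ : ∀ {a b} → a ∧ b ≡ true → a ≡ true
∧-elimˡ {true} _ = refl

∧-elimʳ : ∀ {a b} → a ∧ b ≡ true → b ≡ true
∧-elimʳ {true} p = p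

∨-elim : ∀ {a b} → a ∨ b ≡ true → a ≡ true ⊎ b ≡ true
∨-elim {true} _ = inj₁ refl
∨-elim {false} p = inj₂ p

∨-introˡ : ∀ {a b} → a ≡ true → a ∨ b ≡ true
∨-introˡ refl = refl

∨-introʳ : ∀ {a b} → b ≡ true → a ∨ b ≡ true
∨-introʳ {true} _ = refl
∨-introʳ {false} p = p

≡false⇒not≡true : ∀ {a} → a ≡ false → not a ≡ true
≡false⇒not≡true refl = refl

not≡true⇒≡false : ∀ {a} → not a ≡ true → a ≡ false
not≡true⇒≡false {false} _ = refl

≡true⇒≢false : ∀ {a} → a ≡ true → a ≡ false → ⊥
≡true⇒≢false refl ()

≢true⇒≡false : ∀ {a} → ¬ a ≡ true → a ≡ false
≢true⇒≡false {true} p = ⊥-elim (p refl)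
≢true⇒≡false {false} _ = refl

true-or-false : (a : Bool) → a ≡ true ⊎ a ≡ false
true-or-false true = inj₁ refl
true-or-false false = inj₂ refl

≟-diag : (x : Fin n) → ⌊ x ≟ x ⌋ ≡ true
≟-diag x with x ≟ x
... | yes _ = refl
... | no x≢x = ⊥-elim (x≢x refl)

≟-true⇒≡ : {x y : Fin n} → ⌊ x ≟ y ⌋ ≡ true → x ≡ y
≟-true⇒≡ {x = x} {y} p with x ≟ y
... | yes q = q

≢⇒not-≟ : {x y : Fin n} → ¬ x ≡ y → not ⌊ x ≟ y ⌋ ≡ true
≢⇒not-≟ {x = x} {y} p with x ≟ y
... | yes q = ⊥-elim (p q)
... | no _ = refl

not-≟⇒≢ : {x y : Fin n} → not ⌊ x ≟ y ⌋ ≡ true → ¬ x ≡ y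
not-≟⇒≢ {x = x} p refl = ≡true⇒≢false (≟-diag x) (not≡true⇒≡false p)

sumFin : (Fin n → ℕ) → ℕ
sumFin {n} f = sum (map f (allFin n))

sumFin-suc : (f : Fin (suc n) → ℕ) → sumFin f ≡ f zero + sumFin (f ∘ suc)
sumFin-suc f = cong (λ l → f zero + sum l)
  (trans (map-tabulate suc f) (≡-sym (map-tabulate id (f ∘ suc))))

sumFin-mono : (f g : Fin n → ℕ) → (∀ x → f x ≤ g x) → sumFin f ≤ sumFin g
sumFin-mono {zero} f g p = z≤n
sumFin-mono {suc n} f g p rewrite sumFin-suc f | sumFin-suc g =
  +-mono-≤ (p zero) (sumFin-mono (f ∘ suc) (g ∘ suc) (p ∘ suc))

sumFin-cong : (f g : Fin n → ℕ) → (∀ x → f x ≡ g x) → sumFin f ≡ sumFin g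
sumFin-cong {zero} f g p = refl
sumFin-cong {suc n} f g p rewrite sumFin-suc f | sumFin-suc g =
  cong₂ _+_ (p zero) (sumFin-cong (f ∘ suc) (g ∘ suc) (p ∘ suc))

sumFin-≤-bound : ∀ m (f : Fin n → ℕ) → (∀ x → f x ≤ m) → sumFin f ≤ n * m
sumFin-≤-bound {zero} m f p = z≤n
sumFin-≤-bound {suc n} m f p rewrite sumFin-suc f =
  +-mono-≤ (p zero) (sumFin-≤-bound m (f ∘ suc) (p ∘ suc))

sumFin-mono-≡ : (f g : Fin n → ℕ) → (∀ x → f x ≤ g x) → sumFin g ≤ sumFin f →
                ∀ x → f x ≡ g x
sumFin-mono-≡ {suc n} f g p q x rewrite sumFin-suc f | sumFin-suc g = pointwise x
  where
  rest≤ : sumFin (f ∘ suc) ≤ sumFin (g ∘ suc)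
  rest≤ = sumFin-mono (f ∘ suc) (g ∘ suc) (p ∘ suc)
  head≥ : g zero ≤ f zero
  head≥ = +-cancelʳ-≤ (sumFin (f ∘ suc)) (g zero) (f zero)
            (≤-trans (+-monoʳ-≤ (g zero) rest≤) q)
  rest≥ : sumFin (g ∘ suc) ≤ sumFin (f ∘ suc)
  rest≥ = +-cancelˡ-≤ (f zero) (sumFin (g ∘ suc)) (sumFin (f ∘ suc))
            (≤-trans (+-monoˡ-≤ (sumFin (g ∘ suc)) (p zero)) q)
  pointwise : ∀ x → f x ≡ g x
  pointwise zero = ≤-antisym (p zero) head≥
  pointwise (suc x) = sumFin-mono-≡ (f ∘ suc) (g ∘ suc) (p ∘ suc) rest≥ x

sumFin-mono-< : (f g : Fin n → ℕ) → (∀ x → f x ≤ g x) → ∀ x → f x < g x → sumFin f < sumFin g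
sumFin-mono-< f g p x q with sumFin f <? sumFin g
... | yes r = r
... | no r = ⊥-elim (<-irrefl (sumFin-mono-≡ f g p (≮⇒≥ r) x) q)

indicator : Bool → ℕ
indicator b = if b then 1 else 0

indicator-mono : ∀ {a b} → (a ≡ true → b ≡ true) → indicator a ≤ indicator b
indicator-mono {true} p rewrite p refl = ≤-refl
indicator-mono {false} p = z≤n

indicator-injective : ∀ {a b} → indicator a ≡ indicator b → a ≡ b
indicator-injective {true} {true} _ = refl
indicator-injective {false} {false} _ = refl

indicator≤1 : ∀ b → indicator b ≤ 1
indicator≤1 true = ≤-refl
indicator≤1 false = z≤n

count-mono : (P Q : Fin n → Bool) → (∀ x → P x ≡ true → Q x ≡ true) → count P ≤ count Q
count-mono P Q p = sumFin-mono (indicator ∘ P) (indicator ∘ Q) (λ x → indicator-mono (p x))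

count-cong : (P Q : Fin n → Bool) → (∀ x → P x ≡ Q x) → count P ≡ count Q
count-cong P Q p = sumFin-cong (indicator ∘ P) (indicator ∘ Q) (cong indicator ∘ p)

count-mono-≡ : (P Q : Fin n → Bool) → (∀ x → P x ≡ true → Q x ≡ true) →
               count Q ≤ count P → ∀ x → P x ≡ Q x
count-mono-≡ P Q p q x = indicator-injective
  (sumFin-mono-≡ (indicator ∘ P) (indicator ∘ Q) (λ x → indicator-mono (p x)) q x)

count-mono-< : (P Q : Fin n → Bool) → (∀ x → P x ≡ true → Q x ≡ true) →
               ∀ x → Q x ≡ true → P x ≡ false → count P < count Q
count-mono-< P Q p x q r = sumFin-mono-< (indicator ∘ P) (indicator ∘ Q)
  (λ x → indicator-mono (p x)) x (subst₂ (λ a b → indicator a < indicator b) (≡-sym r) (≡-sym q) ≤-refl)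

count≤n : (P : Fin n → Bool) → count P ≤ n
count≤n {n} P = subst (count P ≤_) (*-identityʳ n)
  (sumFin-≤-bound 1 (indicator ∘ P) (indicator≤1 ∘ P))

count-false : count {n} (λ _ → false) ≡ 0
count-false {zero} = refl
count-false {suc n} rewrite sumFin-suc {n} (λ _ → 0) = count-false {n}

count-nowhere : (P : Fin n → Bool) → (∀ x → P x ≡ false) → count P ≡ 0
count-nowhere {n} P p = trans (count-cong P (λ _ → false) p) (count-false {n})

count-pos : (P : Fin n → Bool) → ∀ x → P x ≡ true → 1 ≤ count P
count-pos {n} P x p = subst (_< count P) (count-false {n}) (count-mono-< (λ _ → false) P (λ _ ()) x p refl)

count-pos⇒∃ : (P : Fin n → Bool) → 1 ≤ count P → ∃ λ x → P x ≡ true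
count-pos⇒∃ P c with any? (λ x → P x ≟ᵇ true)
... | yes e = e
... | no ne = ⊥-elim (<-irrefl refl (subst (1 ≤_) (count-nowhere P (λ x → ≢true⇒≡false (λ q → ne (x , q)))) c))

count-≟≤1 : (v : Fin n) → count (λ y → ⌊ y ≟ v ⌋) ≤ 1
count-≟≤1 {suc n} zero rewrite sumFin-suc (λ y → indicator ⌊ y ≟ (zero {n}) ⌋) =
  ≤-reflexive (cong suc (count-nowhere {n} (λ y → ⌊ suc y ≟ zero ⌋) (λ _ → refl)))
count-≟≤1 {suc n} (suc v) rewrite sumFin-suc (λ y → indicator ⌊ y ≟ suc v ⌋) =
  ≤-trans (≤-reflexive (count-cong _ _ ≟-suc)) (count-≟≤1 v)
  where
  ≟-suc : ∀ y → ⌊ suc y ≟ suc v ⌋ ≡ ⌊ y ≟ v ⌋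
  ≟-suc y with suc y ≟ suc v | y ≟ v
  ... | yes p | yes q = refl
  ... | no p | no q = refl
  ... | yes p | no q = ⊥-elim (q (suc-injective p))
  ... | no p | yes refl = ⊥-elim (p refl)

count≤1 : (P : Fin n → Bool) (v : Fin n) → (∀ x → P x ≡ true → x ≡ v) → count P ≤ 1
count≤1 P v f = ≤-trans (count-mono P (λ y → ⌊ y ≟ v ⌋) at-v) (count-≟≤1 v)
  where
  at-v : ∀ y → P y ≡ true → ⌊ y ≟ v ⌋ ≡ true
  at-v y q = subst (λ z → ⌊ y ≟ z ⌋ ≡ true) (f y q) (≟-diag y)

count≥2 : (P : Fin n → Bool) → ∀ x y → P x ≡ true → P y ≡ true → ¬ x ≡ y → 2 ≤ count P
count≥2 P x y px py x≢y =
  ≤-trans (s≤s (count-pos P-x y (∧-intro py (≢⇒not-≟ (λ e → x≢y (≡-sym e))))))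
          (count-mono-< P-x P (λ z → ∧-elimˡ) x px (subst (λ b → P x ∧ not b ≡ false) (≡-sym (≟-diag x)) (∧-zeroʳ (P x))))
  where
  P-x = λ z → P z ∧ not ⌊ z ≟ x ⌋

count≤1⇒unique : (P : Fin n → Bool) → count P ≤ 1 → ∀ x y → P x ≡ true → P y ≡ true → x ≡ y
count≤1⇒unique P c x y px py with x ≟ y
... | yes e = e
... | no ne = ⊥-elim (<-irrefl refl (≤-trans (count≥2 P x y px py ne) c))

count≥2⇒other : (P : Fin n → Bool) → 2 ≤ count P → ∀ v → ∃ λ z → (P z ∧ not ⌊ z ≟ v ⌋) ≡ true
count≥2⇒other P c2 v with any? (λ z → (P z ∧ not ⌊ z ≟ v ⌋) ≟ᵇ true)
... | yes p = p
... | no p = ⊥-elim (<-irrefl refl (≤-trans c2 (count≤1 P v only-v)))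
  where
  only-v : ∀ x → P x ≡ true → x ≡ v
  only-v x q with x ≟ v
  ... | yes e = e
  ... | no ne = ⊥-elim (p (x , ∧-intro q (≢⇒not-≟ ne)))

-- delete G v and deleteSet B S are definitionally restrictions, so every lemma on restrict applies to them.
restrict : Graph n → (Fin n → Bool) → Graph n
restrict G S = graph (λ x → V G x ∧ S x) (λ x y → E G x y ∧ (S x ∧ S y))

edge-sym : {G : Graph n} → WF G → ∀ {x y} → E G x y ≡ true → E G y x ≡ true
edge-sym w {x} {y} e = trans (sym w y x) e

edge-endʳ : {G : Graph n} → WF G → ∀ {x y} → E G x y ≡ true → V G y ≡ true
edge-endʳ w {x} {y} e = ends w y x (edge-sym w e)

edge-≢ : {G : Graph n} → WF G → ∀ {x y} → E G x y ≡ true → ¬ x ≡ y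
edge-≢ w {x} e refl = ≡true⇒≢false e (irrefl w x)

wf-restrict : {G : Graph n} (S : Fin n → Bool) → WF G → WF (restrict G S)
wf-restrict {G = G} S w = record
  { ends   = λ x y p → ∧-intro (ends w x y (∧-elimˡ {E G x y} p)) (∧-elimˡ {S x} (∧-elimʳ {E G x y} p))
  ; sym    = λ x y → cong₂ _∧_ (sym w x y) (∧-comm (S x) (S y))
  ; irrefl = λ x → cong (_∧ (S x ∧ S x)) (irrefl w x) }

wf-delete : {G : Graph n} (v : Fin n) → WF G → WF (delete G v)
wf-delete v = wf-restrict (λ x → not ⌊ x ≟ v ⌋)

delete-self : (G : Graph n) (v : Fin n) → V (delete G v) v ≡ false
delete-self G v = subst (λ b → V G v ∧ not b ≡ false) (≡-sym (≟-diag v)) (∧-zeroʳ (V G v))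

subgraph : {H G : Graph n} → WF H → (∀ x → V H x ≡ true → V G x ≡ true) →
           (∀ x y → E H x y ≡ true → E G x y ≡ true) → Subgraph H G
subgraph w v e = record { wf = w ; subV = v ; subE = e }

⊆-refl : {G : Graph n} → WF G → Subgraph G G
⊆-refl w = subgraph w (λ _ p → p) (λ _ _ p → p)

⊆-trans : {A B C : Graph n} → Subgraph A B → Subgraph B C → Subgraph A C
⊆-trans s t = subgraph (wf s) (λ x → subV t x ∘ subV s x) (λ x y → subE t x y ∘ subE s x y)

restrict-⊆ : {G : Graph n} (S : Fin n → Bool) → WF G → Subgraph (restrict G S) G
restrict-⊆ {G = G} S w = subgraph (wf-restrict S w) (λ x → ∧-elimˡ {V G x}) (λ x y → ∧-elimˡ {E G x y})

⊆-restrict : {H G : Graph n} (S : Fin n → Bool) → Subgraph H G →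
             (∀ x → V H x ≡ true → S x ≡ true) → Subgraph H (restrict G S)
⊆-restrict S s h = subgraph (wf s) (λ x p → ∧-intro (subV s x p) (h x p))
  (λ x y p → ∧-intro (subE s x y p) (∧-intro (h x (ends (wf s) x y p)) (h y (edge-endʳ (wf s) p))))

restrict-mono : {H G : Graph n} (S T : Fin n → Bool) → Subgraph H G →
                (∀ x → V H x ≡ true → S x ≡ true → T x ≡ true) → Subgraph (restrict H S) (restrict G T)
restrict-mono {H = H} S T s h = ⊆-restrict T (⊆-trans (restrict-⊆ S (wf s)) s)
  (λ x p → h x (∧-elimˡ {V H x} p) (∧-elimʳ {V H x} p))

delete-mono : {H G : Graph n} (v : Fin n) → Subgraph H G → Subgraph (delete H v) (delete G v)
delete-mono v s = restrict-mono (λ x → not ⌊ x ≟ v ⌋) (λ x → not ⌊ x ≟ v ⌋) s (λ _ _ p → p)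

⊆-delete : {H G : Graph n} (v : Fin n) → Subgraph H G → V H v ≡ false → Subgraph H (delete G v)
⊆-delete v s hv = ⊆-restrict (λ x → not ⌊ x ≟ v ⌋) s
  (λ x p → ≢⇒not-≟ λ { refl → ≡true⇒≢false p hv })

⊆-antisym : {H G : Graph n} → Subgraph H G → Subgraph G H → H ≅ G
⊆-antisym s t = (λ x → both (subV s x) (subV t x)) , (λ x y → both (subE s x y) (subE t x y))
  where
  both : ∀ {a b} → (a ≡ true → b ≡ true) → (b ≡ true → a ≡ true) → a ≡ b
  both {true} f g = ≡-sym (f refl)
  both {false} {true} f g = g refl
  both {false} {false} f g = refl

≅-sym : {H G : Graph n} → H ≅ G → G ≅ H
≅-sym (pv , pe) = (λ x → ≡-sym (pv x)) , (λ x y → ≡-sym (pe x y))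

≅-wf : {H G : Graph n} → WF G → H ≅ G → WF H
≅-wf w (pv , pe) = record
  { ends   = λ x y p → trans (pv x) (ends w x y (trans (≡-sym (pe x y)) p))
  ; sym    = λ x y → trans (pe x y) (trans (sym w x y) (≡-sym (pe y x)))
  ; irrefl = λ x → trans (pe x x) (irrefl w x) }

≅⇒⊆ : {H G : Graph n} → WF H → H ≅ G → Subgraph H G
≅⇒⊆ w (pv , pe) = subgraph w (λ x p → trans (≡-sym (pv x)) p) (λ x y p → trans (≡-sym (pe x y)) p)

⊆-respˡ-≅ : {H H' G : Graph n} → H ≅ H' → Subgraph H G → Subgraph H' G
⊆-respˡ-≅ hh s = ⊆-trans (≅⇒⊆ (≅-wf (wf s) (≅-sym hh)) (≅-sym hh)) s

⊆-respʳ-≅ : {H G G' : Graph n} → G ≅ G' → Subgraph H G → Subgraph H G'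
⊆-respʳ-≅ (pv , pe) s = subgraph (wf s) (λ x p → trans (≡-sym (pv x)) (subV s x p))
                                       (λ x y p → trans (≡-sym (pe x y)) (subE s x y p))

walk-map : {H G : Graph n} → (∀ x → V H x ≡ true → V G x ≡ true) →
           (∀ x y → E H x y ≡ true → E G x y ≡ true) → ∀ {a b} → Walk H a b → Walk G a b
walk-map fv fe (here p) = here (fv _ p)
walk-map fv fe (step e w) = step (fe _ _ e) (walk-map fv fe w)

walk-≅ : {H H' : Graph n} → H ≅ H' → ∀ {a b} → Walk H a b → Walk H' a b
walk-≅ (pv , pe) = walk-map (λ x p → trans (≡-sym (pv x)) p) (λ x y p → trans (≡-sym (pe x y)) p)

walk-target : {H : Graph n} {a b : Fin n} → Walk H a b → V H b ≡ true
walk-target (here p) = p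
walk-target (step e w) = walk-target w

_++ʷ_ : {H : Graph n} {a b c : Fin n} → Walk H a b → Walk H b c → Walk H a c
here p ++ʷ v = v
step e w ++ʷ v = step e (w ++ʷ v)

walk-reverse : {H : Graph n} → WF H → ∀ {a b} → Walk H a b → Walk H b a
walk-reverse w (here p) = here p
walk-reverse w (step e u) = walk-reverse w u ++ʷ step (edge-sym w e) (here (ends w _ _ e))

walk-preserves : {H : Graph n} (Q : Fin n → Set) → (∀ c d → Q c → E H c d ≡ true → Q d) →
                 ∀ {a b} → Walk H a b → Q a → Q b
walk-preserves Q f (here p) q = q
walk-preserves Q f (step e w) q = walk-preserves Q f w (f _ _ q e)

Closed : Graph n → (Fin n → Bool) → Set
Closed W S = ∀ c d → S c ≡ true → E W c d ≡ true → S d ≡ true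

walk-restrict : {W : Graph n} (S : Fin n → Bool) → Closed W S →
                ∀ {a b} → Walk W a b → S a ≡ true → Walk (restrict W S) a b
walk-restrict S f (here p) s = here (∧-intro p s)
walk-restrict S f (step e w) s = step (∧-intro e (∧-intro s (f _ _ s e))) (walk-restrict S f w (f _ _ s e))

walk-edgeless : {H : Graph n} → (∀ x y → E H x y ≡ false) → ∀ {a b} → Walk H a b → a ≡ b
walk-edgeless f (here p) = refl
walk-edgeless f (step e w) = ⊥-elim (≡true⇒≢false e (f _ _))

walk-leaves : {H : Graph n} (R : Fin n → Bool) → ∀ {a b} → Walk H a b → R a ≡ true → R b ≡ false →
              ∃ λ c → ∃ λ d → R c ≡ true × R d ≡ false × E H c d ≡ true
walk-leaves R (here p) ra rb = ⊥-elim (≡true⇒≢false ra rb)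
walk-leaves R (step {y = y} e w) ra rb with true-or-false (R y)
... | inj₁ ry = walk-leaves R w ry rb
... | inj₂ ry = _ , y , ra , ry , e

anyFin : (Fin n → Bool) → Bool
anyFin f = ⌊ any? (λ c → f c ≟ᵇ true) ⌋

anyFin-true : (f : Fin n → Bool) → anyFin f ≡ true → ∃ λ c → f c ≡ true
anyFin-true f p with any? (λ c → f c ≟ᵇ true)
... | yes q = q

anyFin-intro : (f : Fin n → Bool) (c : Fin n) → f c ≡ true → anyFin f ≡ true
anyFin-intro f c p with any? (λ c → f c ≟ᵇ true)
... | yes q = refl
... | no q = ⊥-elim (q (c , p))

expand : Graph n → (Fin n → Bool) → Fin n → Bool
expand W S z = S z ∨ anyFin (λ c → S c ∧ E W c z)

expandⁱ : Graph n → ℕ → (Fin n → Bool) → Fin n → Bool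
expandⁱ W zero S = S
expandⁱ W (suc i) S = expand W (expandⁱ W i S)

closed-or-escape : (W : Graph n) (S : Fin n → Bool) →
  Closed W S ⊎ (∃ λ c → ∃ λ d → S c ≡ true × E W c d ≡ true × S d ≡ false)
closed-or-escape W S with any? (λ c → any? (λ d → (S c ∧ E W c d ∧ not (S d)) ≟ᵇ true))
... | yes (c , d , p) = inj₂ (c , d , ∧-elimˡ {S c} p , ∧-elimˡ {E W c d} (∧-elimʳ {S c} p) ,
                              not≡true⇒≡false (∧-elimʳ {E W c d} (∧-elimʳ {S c} p)))
... | no q = inj₁ λ c d sc e → closed c d sc e (true-or-false (S d))
  where
  closed : ∀ c d → S c ≡ true → E W c d ≡ true → S d ≡ true ⊎ S d ≡ false → S d ≡ true
  closed c d sc e (inj₁ p) = p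
  closed c d sc e (inj₂ p) = ⊥-elim (q (c , d , ∧-intro sc (∧-intro e (≡false⇒not≡true p))))

expand-closed : (W : Graph n) (S : Fin n → Bool) → Closed W S → ∀ z → expand W S z ≡ S z
expand-closed W S cl z with true-or-false (S z)
... | inj₁ p rewrite p = refl
... | inj₂ p rewrite p with true-or-false (anyFin (λ c → S c ∧ E W c z))
...   | inj₂ q = q
...   | inj₁ q with anyFin-true _ q
...     | c , r = ⊥-elim (≡true⇒≢false (cl c z (∧-elimˡ {S c} r) (∧-elimʳ {S c} r)) p)

closed-cong : (W : Graph n) (S T : Fin n → Bool) → Closed W S → (∀ z → T z ≡ S z) → Closed W T
closed-cong W S T cl eq c d tc e = trans (eq d) (cl c d (trans (≡-sym (eq c)) tc) e)

expandⁱ-closed-or-grows : (W : Graph n) (S : Fin n → Bool) → 1 ≤ count S → ∀ i →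
                          Closed W (expandⁱ W i S) ⊎ suc i ≤ count (expandⁱ W i S)
expandⁱ-closed-or-grows W S c0 zero = inj₂ c0
expandⁱ-closed-or-grows W S c0 (suc i) with expandⁱ-closed-or-grows W S c0 i
... | inj₁ cl = inj₁ (closed-cong W _ _ cl (expand-closed W _ cl))
... | inj₂ ci with closed-or-escape W (expandⁱ W i S)
...   | inj₁ cl = inj₁ (closed-cong W _ _ cl (expand-closed W _ cl))
...   | inj₂ (c , d , sc , e , sd) = inj₂ (≤-trans (s≤s ci)
          (count-mono-< (expandⁱ W i S) (expandⁱ W (suc i) S) (λ _ → ∨-introˡ) d
             (∨-introʳ {expandⁱ W i S d} (anyFin-intro _ c (∧-intro sc e))) sd))

expandⁱ-⊇ : (W : Graph n) (S : Fin n → Bool) → ∀ i z → S z ≡ true → expandⁱ W i S z ≡ true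
expandⁱ-⊇ W S zero z p = p
expandⁱ-⊇ W S (suc i) z p = ∨-introˡ (expandⁱ-⊇ W S i z p)

-- n steps suffice: until it is closed, the i-th iterate has more than i of the n vertices.
reach : Graph n → Fin n → Fin n → Bool
reach {n} W a = expandⁱ W n (λ z → ⌊ z ≟ a ⌋)

reach-closed : (W : Graph n) (a : Fin n) → Closed W (reach W a)
reach-closed {n} W a with expandⁱ-closed-or-grows W (λ z → ⌊ z ≟ a ⌋) (count-pos _ a (≟-diag a)) n
... | inj₁ cl = cl
... | inj₂ c = ⊥-elim (<-irrefl refl (≤-trans c (count≤n _)))

reach-self : (W : Graph n) (a : Fin n) → reach W a a ≡ true
reach-self {n} W a = expandⁱ-⊇ W _ n a (≟-diag a)

expandⁱ-sound : (W : Graph n) → WF W → ∀ a → V W a ≡ true → ∀ i z →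
                expandⁱ W i (λ z → ⌊ z ≟ a ⌋) z ≡ true → Walk W a z
expandⁱ-sound W w a va zero z p with ≟-true⇒≡ p
... | refl = here va
expandⁱ-sound W w a va (suc i) z p with ∨-elim {expandⁱ W i _ z} p
... | inj₁ q = expandⁱ-sound W w a va i z q
... | inj₂ q with anyFin-true _ q
...   | c , r = expandⁱ-sound W w a va i c (∧-elimˡ {expandⁱ W i _ c} r)
                ++ʷ step (∧-elimʳ {expandⁱ W i _ c} r) (here (edge-endʳ w (∧-elimʳ {expandⁱ W i _ c} r)))

reach-sound : (W : Graph n) → WF W → ∀ a → V W a ≡ true → ∀ z → reach W a z ≡ true → Walk W a z
reach-sound {n} W w a va = expandⁱ-sound W w a va n

reach-complete : (W : Graph n) (a : Fin n) → ∀ {z} → Walk W a z → reach W a z ≡ true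
reach-complete W a wk = walk-preserves (λ d → reach W a d ≡ true) (reach-closed W a) wk (reach-self W a)

reach-vertex : (W : Graph n) → WF W → ∀ a → V W a ≡ true → ∀ z → reach W a z ≡ true → V W z ≡ true
reach-vertex W w a va z p = walk-target (reach-sound W w a va z p)

walk? : (W : Graph n) → WF W → ∀ a → V W a ≡ true → ∀ b → Dec (Walk W a b)
walk? W w a va b with true-or-false (reach W a b)
... | inj₁ p = yes (reach-sound W w a va b p)
... | inj₂ p = no λ wk → ≡true⇒≢false (reach-complete W a wk) p

Unlinked : Graph n → Set
Unlinked W = ∃ λ x → ∃ λ y → V W x ≡ true × V W y ≡ true × ¬ Walk W x y

linked-or-unlinked : (W : Graph n) → WF W → AllLinked W ⊎ Unlinked W
linked-or-unlinked W w with any? (λ x → any? (λ y → unlinked? x y))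
  where
  unlinked? : ∀ x y → Dec (V W x ≡ true × V W y ≡ true × ¬ Walk W x y)
  unlinked? x y with true-or-false (V W x) | true-or-false (V W y)
  ... | inj₂ p | _ = no λ { (q , _) → ≡true⇒≢false q p }
  ... | inj₁ p | inj₂ q = no λ { (_ , r , _) → ≡true⇒≢false r q }
  ... | inj₁ p | inj₁ q with walk? W w x p y
  ...   | yes wk = no λ { (_ , _ , nw) → nw wk }
  ...   | no nw = yes (p , q , nw)
... | yes u = inj₂ u
... | no nu = inj₁ λ x y vx vy → linked x y vx vy
  where
  linked : ∀ x y → V W x ≡ true → V W y ≡ true → Walk W x y
  linked x y vx vy with walk? W w x vx y
  ... | yes wk = wk
  ... | no nw = ⊥-elim (nu (x , y , vx , vy , nw))

nonnull-or-null : (W : Graph n) → (∃ λ x → V W x ≡ true) ⊎ IsNull W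
nonnull-or-null W with any? (λ x → V W x ≟ᵇ true)
... | yes p = inj₁ p
... | no p = inj₂ λ x → ≢true⇒≡false λ q → p (x , q)

CutVertex : Graph n → Set
CutVertex W = ∃ λ v → V W v ≡ true × Unlinked (delete W v)

no-cut-or-cut : (W : Graph n) → WF W → (∀ v → V W v ≡ true → AllLinked (delete W v)) ⊎ CutVertex W
no-cut-or-cut W w with any? cut?
  where
  cut? : ∀ v → Dec (V W v ≡ true × Unlinked (delete W v))
  cut? v with true-or-false (V W v)
  ... | inj₂ p = no λ { (q , _) → ≡true⇒≢false q p }
  ... | inj₁ p with linked-or-unlinked (delete W v) (wf-delete v w)
  ...   | inj₁ l = no λ { (_ , x , y , vx , vy , nw) → nw (l x y vx vy) }
  ...   | inj₂ r = yes (p , r)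
... | yes c = inj₂ c
... | no nc = inj₁ λ v vv → no-cut v vv
  where
  no-cut : ∀ v → V W v ≡ true → AllLinked (delete W v)
  no-cut v vv with linked-or-unlinked (delete W v) (wf-delete v w)
  ... | inj₁ l = l
  ... | inj₂ q = ⊥-elim (nc (v , vv , q))

nocut? : (W : Graph n) → WF W → Dec (NoCutConnected W)
nocut? W w with nonnull-or-null W | linked-or-unlinked W w | no-cut-or-cut W w
... | inj₂ nl | _ | _ = no λ { (((x , p) , _) , _) → ≡true⇒≢false p (nl x) }
... | inj₁ _ | inj₂ (x , y , vx , vy , nw) | _ = no λ { ((_ , l) , _) → nw (l x y vx vy) }
... | inj₁ _ | inj₁ _ | inj₂ (v , vv , x , y , vx , vy , nw) = no λ { (_ , c) → nw (c v vv x y vx vy) }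
... | inj₁ ne | inj₁ l | inj₁ c = yes ((ne , l) , c)

nocut⇒oneblock : {X : Graph n} → WF X → NoCutConnected X → OneBlock X
nocut⇒oneblock w nc = record { sub = ⊆-refl w ; nocut = nc ; maximal = λ H s _ t → ⊆-antisym s t }

oneblock? : (X : Graph n) → WF X → Dec (OneBlock X)
oneblock? X w with nocut? X w
... | yes p = yes (nocut⇒oneblock w p)
... | no p = no λ b → p (nocut b)

block⇒oneblock : {B X : Graph n} → IsBlock B X → OneBlock B
block⇒oneblock b = nocut⇒oneblock (wf (sub b)) (nocut b)

-- Maximality in IsBlock quantifies over all graphs on Fin n, so extending to a block needs exhaustive search.
Searchable : (A : Set) → (A → A → Set) → Set₁
Searchable A _~_ = ∀ (P : A → Set) → (∀ a b → a ~ b → P a → P b) → (∀ a → Dec (P a)) → Dec (∃ P)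

searchable-Bool : Searchable Bool _≡_
searchable-Bool P resp P? with P? true | P? false
... | yes p | _ = yes (true , p)
... | no _ | yes q = yes (false , q)
... | no p | no q = no λ { (true , r) → p r ; (false , r) → q r }

cons : {A : Set} {m : ℕ} → A → (Fin m → A) → Fin (suc m) → A
cons a g zero = a
cons a g (suc i) = g i

searchable-Fin→ : {A : Set} {_~_ : A → A → Set} → (∀ a → a ~ a) → Searchable A _~_ →
                  ∀ m → Searchable (Fin m → A) (λ f g → ∀ i → f i ~ g i)
searchable-Fin→ rf sA zero P resp P? with P? (λ ())
... | yes p = yes ((λ ()) , p)
... | no p = no λ { (f , q) → p (resp f (λ ()) (λ ()) q) }
searchable-Fin→ {A} {_~_} rf sA (suc m) P resp P? with sA (λ a → ∃ λ g → P (cons a g)) resp-head head?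
  where
  resp-head : ∀ a b → a ~ b → (∃ λ g → P (cons a g)) → ∃ λ g → P (cons b g)
  resp-head a b ab (g , p) = g , resp (cons a g) (cons b g) (λ { zero → ab ; (suc i) → rf (g i) }) p
  head? : ∀ a → Dec (∃ λ g → P (cons a g))
  head? a = searchable-Fin→ rf sA m (λ g → P (cons a g))
              (λ f g fg → resp (cons a f) (cons a g) (λ { zero → rf a ; (suc i) → fg i })) (λ g → P? (cons a g))
... | yes (a , g , p) = yes (cons a g , p)
... | no np = no λ { (f , q) → np (f zero , f ∘ suc ,
                       resp f _ (λ { zero → rf (f zero) ; (suc i) → rf (f (suc i)) }) q) }

searchable-Graph : Searchable (Graph n) _≅_
searchable-Graph {n} P resp P? with searchable-Fin→ (λ _ → refl) searchable-Bool n
                                      (λ VV → ∃ λ EE → P (graph VV EE)) resp-V edges?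
  where
  sV = searchable-Fin→ (λ _ → refl) searchable-Bool n
  sE = searchable-Fin→ {_~_ = λ f g → ∀ i → f i ≡ g i} (λ _ _ → refl) sV n
  resp-V : ∀ a b → (∀ i → a i ≡ b i) → (∃ λ EE → P (graph a EE)) → ∃ λ EE → P (graph b EE)
  resp-V a b ab (EE , p) = EE , resp _ _ (ab , (λ _ _ → refl)) p
  edges? : ∀ VV → Dec (∃ λ EE → P (graph VV EE))
  edges? VV = sE (λ EE → P (graph VV EE)) (λ e e' ee p → resp _ _ ((λ _ → refl) , ee) p) (λ EE → P? (graph VV EE))
... | yes (VV , EE , p) = yes (graph VV EE , p)
... | no np = no λ { (G , p) → np (V G , E G , p) }

implies? : (a b : Bool) → Dec (a ≡ true → b ≡ true)
implies? false b = yes λ ()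
implies? true true = yes λ _ → refl
implies? true false = no λ f → ≡true⇒≢false (f refl) refl

wf? : (H : Graph n) → Dec (WF H)
wf? H with all? (λ x → all? (λ y → implies? (E H x y) (V H x)))
         | all? (λ x → all? (λ y → E H x y ≟ᵇ E H y x))
         | all? (λ x → E H x x ≟ᵇ false)
... | yes a | yes b | yes c = yes record { ends = a ; sym = b ; irrefl = c }
... | no a | _ | _ = no λ w → a (ends w)
... | yes _ | no b | _ = no λ w → b (sym w)
... | yes _ | yes _ | no c = no λ w → c (irrefl w)

⊆? : (H G : Graph n) → Dec (Subgraph H G)
⊆? H G with wf? H | all? (λ x → implies? (V H x) (V G x))
                  | all? (λ x → all? (λ y → implies? (E H x y) (E G x y)))
... | yes w | yes a | yes b = yes (subgraph w a b)
... | no w | _ | _ = no λ s → w (wf s)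
... | yes _ | no a | _ = no λ s → a (subV s)
... | yes _ | yes _ | no b = no λ s → b (subE s)

linked-≅ : {H H' : Graph n} → H ≅ H' → AllLinked H → AllLinked H'
linked-≅ hh l x y vx vy = walk-≅ hh (l x y (trans (proj₁ hh x) vx) (trans (proj₁ hh y) vy))

nocut-≅ : {H H' : Graph n} → H ≅ H' → NoCutConnected H → NoCutConnected H'
nocut-≅ {H = H} {H'} hh (((x , vx) , l) , c) =
  ((x , trans (≡-sym (proj₁ hh x)) vx) , linked-≅ hh l) ,
  λ v vv → linked-≅ (delete-≅ v) (c v (trans (proj₁ hh v) vv))
  where
  delete-≅ : ∀ v → delete H v ≅ delete H' v
  delete-≅ v = (λ x → cong (_∧ _) (proj₁ hh x)) , (λ x y → cong (_∧ _) (proj₂ hh x y))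

-- Vertices plus ordered edges: a proper subgraph is strictly smaller.
size : Graph n → ℕ
size H = count (V H) + sumFin (λ x → count (E H x))

size-cong : {H H' : Graph n} → H ≅ H' → size H ≡ size H'
size-cong (pv , pe) = cong₂ _+_ (count-cong _ _ pv) (sumFin-cong _ _ (λ x → count-cong _ _ (pe x)))

size≤ : (H : Graph n) → size H ≤ n + n * n
size≤ {n} H = +-mono-≤ (count≤n (V H)) (sumFin-≤-bound n _ (λ x → count≤n (E H x)))

size-mono-≅ : {C H : Graph n} → Subgraph C H → size H ≤ size C → H ≅ C
size-mono-≅ {C = C} {H} s le =
  (λ x → ≡-sym (count-mono-≡ _ _ (subV s) vertices≤ x)) ,
  (λ x y → ≡-sym (count-mono-≡ _ _ (subE s x) (≤-reflexive (≡-sym (edges≡ x))) y))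
  where
  V≤ = count-mono _ _ (subV s)
  E≤ = sumFin-mono _ _ (λ x → count-mono _ _ (subE s x))
  vertices≤ : count (V H) ≤ count (V C)
  vertices≤ = +-cancelʳ-≤ _ _ _ (≤-trans (+-monoʳ-≤ (count (V H)) E≤) le)
  edges≤ : sumFin (λ x → count (E H x)) ≤ sumFin (λ x → count (E C x))
  edges≤ = +-cancelˡ-≤ _ _ _ (≤-trans (+-monoˡ-≤ (sumFin (λ x → count (E H x))) V≤) le)
  edges≡ : ∀ x → count (E C x) ≡ count (E H x)
  edges≡ = sumFin-mono-≡ _ _ (λ x → count-mono _ _ (subE s x)) edges≤

StrictNoCutExtension : Graph n → Graph n → Graph n → Set
StrictNoCutExtension X C H = Subgraph H X × NoCutConnected H × Subgraph C H × size C < size H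

strictNoCutExtension? : (X C H : Graph n) → Dec (StrictNoCutExtension X C H)
strictNoCutExtension? X C H with ⊆? H X
... | no p = no (p ∘ proj₁)
... | yes s with nocut? H (wf s) | ⊆? C H | size C <? size H
...   | yes a | yes b | yes c = yes (s , a , b , c)
...   | no a | _ | _ = no (a ∘ proj₁ ∘ proj₂)
...   | yes _ | no b | _ = no (b ∘ proj₁ ∘ proj₂ ∘ proj₂)
...   | yes _ | yes _ | no c = no (c ∘ proj₂ ∘ proj₂ ∘ proj₂)

strictNoCutExtension-≅ : (X C H H' : Graph n) → H ≅ H' →
                         StrictNoCutExtension X C H → StrictNoCutExtension X C H'
strictNoCutExtension-≅ X C H H' hh (a , b , c , d) =
  ⊆-respˡ-≅ hh a , nocut-≅ hh b , ⊆-respʳ-≅ hh c , subst (size C <_) (size-cong hh) d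

-- Enlarge C while a larger 2-connected subgraph of X exists; size is bounded by n + n².
extend-to-block : {X C : Graph n} → Subgraph C X → NoCutConnected C →
                  ∃ λ D → IsBlock D X × Subgraph C D
extend-to-block {n} {X} {C} s nc = go (suc (n + n * n)) C s nc (m≤n+m (suc (n + n * n)) (size C))
  where
  go : ∀ fuel C → Subgraph C X → NoCutConnected C → n + n * n < size C + fuel →
       ∃ λ D → IsBlock D X × Subgraph C D
  go zero C s nc b = ⊥-elim (<-irrefl refl (≤-trans b (≤-trans (≤-reflexive (+-identityʳ (size C))) (size≤ C))))
  go (suc f) C s nc b with searchable-Graph (StrictNoCutExtension X C)
                             (strictNoCutExtension-≅ X C) (strictNoCutExtension? X C)
  ... | yes (H , hs , hnc , ch , lt) with go f H hs hnc (≤-trans b (≤-trans (≤-reflexive (+-suc (size C) f)) (+-monoˡ-≤ f lt)))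
  ...   | D , bl , hd = D , bl , ⊆-trans ch hd
  go (suc f) C s nc b | no none = C , record { sub = s ; nocut = nc ; maximal = C-maximal } , ⊆-refl (wf s)
    where
    C-maximal : ∀ H → Subgraph H X → NoCutConnected H → Subgraph C H → H ≅ C
    C-maximal H hs hnc ch = size-mono-≅ ch (≮⇒≥ λ lt → none (H , hs , hnc , ch , lt))

td-≤ : {X : Graph n} {k k' : ℕ} → k ≤ k' → TD2≤ X k → TD2≤ X k'
td-≤ le (null p) = null p
td-≤ (s≤s le) (one ob v vv d) = one ob v vv (td-≤ le d)
td-≤ le (many a b f) = many a b (λ B bl → td-≤ le (f B bl))

td-suc : {X : Graph n} {k : ℕ} → TD2≤ X k → TD2≤ X (suc k)
td-suc = td-≤ (n≤1+n _)

nonnull⇒¬null : {X : Graph n} → (∃ λ x → V X x ≡ true) → ¬ IsNull X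
nonnull⇒¬null (x , p) nl = ≡true⇒≢false p (nl x)

td-from-blocks : {X : Graph n} {k : ℕ} → WF X → (∀ C → IsBlock C X → TD2≤ C k) → TD2≤ X k
td-from-blocks {X = X} w f with nonnull-or-null X
... | inj₂ nl = null nl
... | inj₁ ne with oneblock? X w
...   | yes ob = f X ob
...   | no nob = many (nonnull⇒¬null {X = X} ne) nob f

mutual
  td-⊆ : {X H : Graph n} {k : ℕ} → TD2≤ X k → Subgraph H X → TD2≤ H k
  td-⊆ (null p) s = null (λ x → ≢true⇒≡false λ q → ≡true⇒≢false (subV s x q) (p x))
  td-⊆ (one _ v _ d) s = td-delete (wf s) v (td-⊆ d (delete-mono v s))
  td-⊆ (many _ _ f) s = td-from-blocks (wf s) λ C bl →
    let (D , D-block , C⊆D) = extend-to-block (⊆-trans (sub bl) s) (nocut bl)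
    in  td-⊆ (f D D-block) C⊆D

  td-delete : {Y : Graph n} {k : ℕ} → WF Y → ∀ v → TD2≤ (delete Y v) k → TD2≤ Y (suc k)
  td-delete {Y = Y} w v d with nonnull-or-null Y
  ... | inj₂ nl = null nl
  ... | inj₁ ne with oneblock? Y w | true-or-false (V Y v)
  ...   | _ | inj₂ vv = td-suc (td-⊆ d (⊆-delete v (⊆-refl w) vv))
  ...   | yes ob | inj₁ vv = one ob v vv d
  ...   | no nob | inj₁ _ = many (nonnull⇒¬null {X = Y} ne) nob per-block
    where
    per-block : ∀ C → IsBlock C Y → TD2≤ C _
    per-block C bl with true-or-false (V C v)
    ... | inj₁ cv = one (block⇒oneblock bl) v cv (td-⊆ d (delete-mono v (sub bl)))
    ... | inj₂ cv = td-suc (td-⊆ d (⊆-delete v (sub bl) cv))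

linked-unique : {H : Graph n} (u : Fin n) → (∀ a → V H a ≡ true → a ≡ u) → AllLinked H
linked-unique {H = H} u f a b va vb = subst (Walk H a) (trans (f a va) (≡-sym (f b vb))) (here va)

nocut-unique : {H : Graph n} (u : Fin n) → V H u ≡ true → (∀ a → V H a ≡ true → a ≡ u) → NoCutConnected H
nocut-unique {H = H} u vu f =
  ((u , vu) , linked-unique u f) , λ v _ → linked-unique u (λ a p → f a (∧-elimˡ {V H a} p))

td0⇒null : {Z : Graph n} → WF Z → TD2≤ Z 0 → IsNull Z
td0⇒null {Z = Z} w d z = ≢true⇒≡false λ vz → td-singleton>0 vz (td-⊆ d (restrict-⊆ (≟z) w))
  where
  ≟z = λ x → ⌊ x ≟ z ⌋
  td-singleton>0 : V Z z ≡ true → TD2≤ (restrict Z ≟z) 0 → ⊥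
  td-singleton>0 vz (null p) = ≡true⇒≢false (∧-intro vz (≟-diag z)) (p z)
  td-singleton>0 vz (many _ nob _) = nob (nocut⇒oneblock (wf-restrict ≟z w)
    (nocut-unique z (∧-intro vz (≟-diag z)) (λ a p → ≟-true⇒≡ (∧-elimʳ {V Z a} p))))

pair : Fin n → Fin n → Fin n → Bool
pair x y z = ⌊ z ≟ x ⌋ ∨ ⌊ z ≟ y ⌋

pair-cases : {x y z : Fin n} → pair x y z ≡ true → z ≡ x ⊎ z ≡ y
pair-cases {x = x} {y} {z} p with ∨-elim {⌊ z ≟ x ⌋} p
... | inj₁ q = inj₁ (≟-true⇒≡ q)
... | inj₂ q = inj₂ (≟-true⇒≡ q)

pairˡ : (x y : Fin n) → pair x y x ≡ true
pairˡ x y = ∨-introˡ (≟-diag x)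

pairʳ : (x y : Fin n) → pair x y y ≡ true
pairʳ x y = ∨-introʳ {⌊ y ≟ x ⌋} (≟-diag y)

nocut-edge : {Y : Graph n} → WF Y → ∀ {x y} → E Y x y ≡ true → NoCutConnected (restrict Y (pair x y))
nocut-edge {Y = Y} w {x} {y} e = ((x , vertex x (pairˡ x y)) , linked) , minus
  where
  K = restrict Y (pair x y)
  vertex : ∀ z → pair x y z ≡ true → V K z ≡ true
  vertex z p with pair-cases {x = x} {y} {z} p
  ... | inj₁ refl = ∧-intro (ends w x y e) p
  ... | inj₂ refl = ∧-intro (edge-endʳ w e) p
  linked : AllLinked K
  linked a b va vb with pair-cases {z = a} (∧-elimʳ {V Y a} va) | pair-cases {z = b} (∧-elimʳ {V Y b} vb)
  ... | inj₁ refl | inj₁ refl = here va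
  ... | inj₂ refl | inj₂ refl = here va
  ... | inj₁ refl | inj₂ refl = step (∧-intro e (∧-intro (pairˡ x y) (pairʳ x y))) (here vb)
  ... | inj₂ refl | inj₁ refl = step (∧-intro (edge-sym w e) (∧-intro (pairʳ x y) (pairˡ x y))) (here vb)
  minus : ∀ v → V K v ≡ true → AllLinked (delete K v)
  minus v pv = linked-unique (other (pair-cases {z = v} (∧-elimʳ {V Y v} pv))) only
    where
    other : v ≡ x ⊎ v ≡ y → Fin _
    other (inj₁ _) = y
    other (inj₂ _) = x
    only : ∀ a → V (delete K v) a ≡ true → a ≡ other (pair-cases {z = v} (∧-elimʳ {V Y v} pv))
    only a p with pair-cases {z = v} (∧-elimʳ {V Y v} pv) | pair-cases {z = a} (∧-elimʳ {V Y a} (∧-elimˡ {V K a} p))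
    ... | inj₁ refl | inj₂ a≡y = a≡y
    ... | inj₂ refl | inj₁ a≡x = a≡x
    ... | inj₁ refl | inj₁ refl = ⊥-elim (not-≟⇒≢ (∧-elimʳ {V K a} p) refl)
    ... | inj₂ refl | inj₂ refl = ⊥-elim (not-≟⇒≢ (∧-elimʳ {V K a} p) refl)

td-edge>1 : {Y : Graph n} → WF Y → ∀ {x y} → E Y x y ≡ true → ¬ TD2≤ (restrict Y (pair x y)) 1
td-edge>1 {Y = Y} w {x} {y} e (null p) = ≡true⇒≢false (∧-intro (ends w x y e) (pairˡ x y)) (p x)
td-edge>1 {Y = Y} w {x} {y} e (one _ v _ d) with x ≟ v
... | yes refl = ≡true⇒≢false (∧-intro (∧-intro (edge-endʳ w e) (pairʳ x y)) (≢⇒not-≟ (λ y≡x → edge-≢ w e (≡-sym y≡x))))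
                   (td0⇒null (wf-delete v (wf-restrict (pair x y) w)) d y)
... | no x≢v = ≡true⇒≢false (∧-intro (∧-intro (ends w x y e) (pairˡ x y)) (≢⇒not-≟ x≢v))
                 (td0⇒null (wf-delete v (wf-restrict (pair x y) w)) d x)
td-edge>1 w e (many _ nob _) = nob (nocut⇒oneblock (wf-restrict _ w) (nocut-edge w e))

-- The only consequence of td₂(Y) ≤ k used by the upper bound.
NoCutTD2≤ : Graph n → ℕ → Set
NoCutTD2≤ Y k = ∀ C → Subgraph C Y → NoCutConnected C → TD2≤ C k

td⇒noCutTD : {Y : Graph n} {k : ℕ} → TD2≤ Y k → NoCutTD2≤ Y k
td⇒noCutTD d C s _ = td-⊆ d s

noCutTD-⊆ : {Y Y' : Graph n} {k : ℕ} → NoCutTD2≤ Y k → Subgraph Y' Y → NoCutTD2≤ Y' k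
noCutTD-⊆ q s C c nc = q C (⊆-trans c s) nc

noCutTD1⇒edgeless : {Y : Graph n} → WF Y → NoCutTD2≤ Y 1 → ∀ x y → E Y x y ≡ false
noCutTD1⇒edgeless w q x y = ≢true⇒≡false λ e →
  td-edge>1 w e (q _ (restrict-⊆ (pair x y) w) (nocut-edge w e))


record Separation (X A B : Graph n) : Set where
  field
    A⊆X      : Subgraph A X
    B⊆X      : Subgraph B X
    V-∪      : ∀ x → (V A x ∨ V B x) ≡ V X x
    E-∪      : ∀ x y → (E A x y ∨ E B x y) ≡ E X x y
    shared≤1 : count (λ x → V A x ∧ V B x) ≤ 1

module _ {X A B : Graph n} (sep : Separation X A B) where
  open Separation sep

  shared-unique : ∀ {x y} → V A x ≡ true → V B x ≡ true → V A y ≡ true → V B y ≡ true → x ≡ y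
  shared-unique ax bx ay by = count≤1⇒unique _ shared≤1 _ _ (∧-intro ax bx) (∧-intro ay by)

  ⊆-sideA : {C : Graph n} → Subgraph C X → (∀ x → V C x ≡ true → V A x ≡ true) → Subgraph C A
  ⊆-sideA {C} C⊆X inA = subgraph (wf C⊆X) inA edge
    where
    edge : ∀ x y → E C x y ≡ true → E A x y ≡ true
    edge x y e with ∨-elim {E A x y} (trans (E-∪ x y) (subE C⊆X x y e))
    ... | inj₁ q = q
    ... | inj₂ q = ⊥-elim (edge-≢ (wf C⊆X) e (shared-unique
            (inA x (ends (wf C⊆X) x y e)) (ends (wf B⊆X) x y q) (inA y (edge-endʳ (wf C⊆X) e)) (edge-endʳ (wf B⊆X) q)))

  ⊆-sideB : {C : Graph n} → Subgraph C X → (∀ x → V C x ≡ true → V B x ≡ true) → Subgraph C B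
  ⊆-sideB {C} C⊆X inB = subgraph (wf C⊆X) inB edge
    where
    edge : ∀ x y → E C x y ≡ true → E B x y ≡ true
    edge x y e with ∨-elim {E A x y} (trans (E-∪ x y) (subE C⊆X x y e))
    ... | inj₂ q = q
    ... | inj₁ q = ⊥-elim (edge-≢ (wf C⊆X) e (shared-unique
            (ends (wf A⊆X) x y q) (inB x (ends (wf C⊆X) x y e)) (edge-endʳ (wf A⊆X) q) (inB y (edge-endʳ (wf C⊆X) e))))

  -- An edge at a vertex outside B is an edge of A, so only the shared vertex could lead out of A − V(B).
  walk-stays-A-only : {W : Graph n} → WF W → (∀ c d → E W c d ≡ true → E X c d ≡ true) →
    (∀ d → V W d ≡ true → V A d ≡ true → V B d ≡ false) →
    ∀ {a b} → Walk W a b → V A a ≡ true × V B a ≡ false → V A b ≡ true × V B b ≡ false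
  walk-stays-A-only {W} w W→X unshared = walk-preserves _ move
    where
    move : ∀ c d → V A c ≡ true × V B c ≡ false → E W c d ≡ true → V A d ≡ true × V B d ≡ false
    move c d (ac , bc) e with ∨-elim {E A c d} (trans (E-∪ c d) (W→X c d e))
    ... | inj₂ eb = ⊥-elim (≡true⇒≢false (ends (wf B⊆X) c d eb) bc)
    ... | inj₁ ea = edge-endʳ (wf A⊆X) ea , unshared d (edge-endʳ w e) (edge-endʳ (wf A⊆X) ea)

  ∉B⇒∈A : ∀ {x} → V X x ≡ true → V B x ≡ false → V A x ≡ true
  ∉B⇒∈A {x} vx bx with ∨-elim {V A x} (trans (V-∪ x) vx)
  ... | inj₁ ax = ax
  ... | inj₂ bx' = ⊥-elim (≡true⇒≢false bx' bx)

  nocut-one-sided : {C : Graph n} → Subgraph C X → NoCutConnected C →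
                    ∀ {a b} → V C a ≡ true → V B a ≡ false → V C b ≡ true → V A b ≡ false → ⊥
  nocut-one-sided {C} C⊆X ((_ , linked) , minus) {a} {b} ca ba cb ab
    with any? (λ s → (V C s ∧ (V A s ∧ V B s)) ≟ᵇ true)
  ... | no none = ≡true⇒≢false (proj₁ (walk-stays-A-only (wf C⊆X) (subE C⊆X) unshared
                      (linked a b ca cb) (aA , ba))) ab
    where
    aA = ∉B⇒∈A (subV C⊆X a ca) ba
    unshared : ∀ d → V C d ≡ true → V A d ≡ true → V B d ≡ false
    unshared d cd ad = ≢true⇒≡false λ bd → none (d , ∧-intro cd (∧-intro ad bd))
  ... | yes (s , ps) = ≡true⇒≢false (proj₁ (walk-stays-A-only (wf-delete s (wf C⊆X))
                          (λ c d e → subE C⊆X c d (∧-elimˡ {E C c d} e)) unshared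
                          (minus s cs a b (∧-intro ca (avoid-s {S = B} ba bs)) (∧-intro cb (avoid-s {S = A} ab as))) (aA , ba))) ab
    where
    cs = ∧-elimˡ {V C s} ps
    as = ∧-elimˡ {V A s} (∧-elimʳ {V C s} ps)
    bs = ∧-elimʳ {V A s} (∧-elimʳ {V C s} ps)
    aA = ∉B⇒∈A (subV C⊆X a ca) ba
    avoid-s : ∀ {x} {S : Graph n} → V S x ≡ false → V S s ≡ true → not ⌊ x ≟ s ⌋ ≡ true
    avoid-s sx ss = ≢⇒not-≟ λ { refl → ≡true⇒≢false ss sx }
    unshared : ∀ d → V (delete C s) d ≡ true → V A d ≡ true → V B d ≡ false
    unshared d cd ad = ≢true⇒≡false λ bd →
      not-≟⇒≢ (∧-elimʳ {V C d} cd) (shared-unique ad bd as bs)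


  data Placement (C : Graph n) : Set where
    in-A       : Subgraph C A → Placement C
    in-B-only  : Subgraph C (deleteSet B (V A)) → Placement C
    at-shared  : ∀ s → (V A s ∧ V B s) ≡ true → Subgraph (delete C s) (deleteSet B (V A)) → Placement C

  placement : {C : Graph n} → Subgraph C X → NoCutConnected C → Placement C
  placement {C} C⊆X nc with any? (λ b → (V C b ∧ not (V A b)) ≟ᵇ true)
  ... | no none = in-A (⊆-sideA C⊆X inA)
    where
    inA : ∀ x → V C x ≡ true → V A x ≡ true
    inA x cx with true-or-false (V A x)
    ... | inj₁ ax = ax
    ... | inj₂ ax = ⊥-elim (none (x , ∧-intro cx (≡false⇒not≡true ax)))
  ... | yes (b , pb) = within-B (⊆-sideB C⊆X inB)
    where
    inB : ∀ x → V C x ≡ true → V B x ≡ true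
    inB x cx with true-or-false (V B x)
    ... | inj₁ bx = bx
    ... | inj₂ bx = ⊥-elim (nocut-one-sided C⊆X nc cx bx (∧-elimˡ {V C b} pb) (not≡true⇒≡false (∧-elimʳ {V C b} pb)))
    within-B : Subgraph C B → Placement C
    within-B C⊆B with any? (λ s → (V C s ∧ (V A s ∧ V B s)) ≟ᵇ true)
    ... | no none = in-B-only (⊆-restrict (λ x → not (V A x)) C⊆B λ x cx →
                      ≡false⇒not≡true (≢true⇒≡false λ ax → none (x , ∧-intro cx (∧-intro ax (inB x cx)))))
    ... | yes (s , ps) = at-shared s (∧-elimʳ {V C s} ps)
                           (⊆-restrict (λ x → not (V A x)) (⊆-trans (restrict-⊆ _ (wf C⊆X)) C⊆B) outside-A)
      where
      outside-A : ∀ x → V (delete C s) x ≡ true → not (V A x) ≡ true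
      outside-A x p = ≡false⇒not≡true (≢true⇒≡false λ ax → not-≟⇒≢ (∧-elimʳ {V C x} p)
        (shared-unique ax (inB x (∧-elimˡ {V C x} p)) (∧-elimˡ {V A s} (∧-elimʳ {V C s} ps)) (∧-elimʳ {V A s} (∧-elimʳ {V C s} ps))))

delete-unique-null : {X : Graph n} (v : Fin n) → (∀ x → V X x ≡ true → x ≡ v) → IsNull (delete X v)
delete-unique-null {X = X} v f x with true-or-false (V X x)
... | inj₂ p rewrite p = refl
... | inj₁ p with f x p
...   | refl = delete-self X v

rtd⇒td : {X : Graph n} {k : ℕ} → WF X → RTD2≤ X k → TD2≤ X k
rtd⇒td w (null p) = null p
rtd⇒td {X = X} w (single c) with count-pos⇒∃ (V X) (≤-reflexive (≡-sym c))
... | v , vv = td-delete w v (null (delete-unique-null {X = X} v λ x p → count≤1⇒unique (V X) (≤-reflexive c) x v p vv))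
rtd⇒td {X = X} {k} w (split _ A B A⊆X B⊆X V-∪ E-∪ _ shared≤1 _ _ rA m rB m+shared≤k) = td-from-blocks w per-block
  where
  sep : Separation X A B
  sep = record { A⊆X = A⊆X ; B⊆X = B⊆X ; V-∪ = V-∪ ; E-∪ = E-∪ ; shared≤1 = shared≤1 }
  tdB = rtd⇒td (wf-restrict (λ x → not (V A x)) (wf B⊆X)) rB
  per-block : ∀ C → IsBlock C X → TD2≤ C k
  per-block C bl with placement sep (sub bl) (nocut bl)
  ... | in-A s = td-⊆ (rtd⇒td (wf A⊆X) rA) s
  ... | in-B-only s = td-≤ (≤-trans (m≤m+n m _) m+shared≤k) (td-⊆ tdB s)
  ... | at-shared s sh sd = td-≤ (≤-trans (≤-trans (≤-reflexive (+-comm 1 m)) (+-monoʳ-≤ m (count-pos _ s sh))) m+shared≤k)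
                                 (td-delete (wf (sub bl)) s (td-⊆ tdB sd))


rtd-≤ : {X : Graph n} {k k' : ℕ} → k ≤ k' → RTD2≤ X k → RTD2≤ X k'
rtd-≤ le (null p) = null p
rtd-≤ (s≤s _) (single c) = single c
rtd-≤ le (split c2 A B sA sB vU eU eD cnt neA neB rA m rB le') =
  split c2 A B sA sB vU eU eD cnt neA neB (rtd-≤ le rA) m rB (≤-trans le' le)

singleton : Fin n → Graph n
singleton v = graph (λ x → ⌊ x ≟ v ⌋) (λ _ _ → false)

singleton-⊆ : {Y : Graph n} {v : Fin n} → V Y v ≡ true → Subgraph (singleton v) Y
singleton-⊆ {Y = Y} {v} p = subgraph
  (record { ends = λ _ _ () ; sym = λ _ _ → refl ; irrefl = λ _ → refl })
  (λ x q → subst (λ z → V Y z ≡ true) (≡-sym (≟-true⇒≡ q)) p) (λ _ _ ())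

count-singleton : (v : Fin n) → count (V (singleton v)) ≡ 1
count-singleton v = ≤-antisym (count≤1 _ v (λ x → ≟-true⇒≡)) (count-pos _ v (≟-diag v))

-- Split off the single vertex v as A; then B − V(A) is Y − v.
rtd-delete : {Y : Graph n} {v : Fin n} {m : ℕ} → WF Y → V Y v ≡ true →
             RTD2≤ (delete Y v) m → RTD2≤ Y (suc m)
rtd-delete {Y = Y} {v} {m} w vv r with count (V Y) ≤? 1
... | yes c1 = single (≤-antisym c1 (count-pos (V Y) v vv))
... | no c1 with count≥2⇒other (V Y) (≰⇒> c1) v
...   | z , pz = split (≰⇒> c1) (singleton v) Y (singleton-⊆ vv) (⊆-refl w) V-∪ (λ _ _ → refl) (λ _ _ → refl)
                   shared≤1 (v , ≟-diag v) (z , pz) (single (count-singleton v)) m r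
                   (≤-trans (+-monoʳ-≤ m shared≤1) (≤-reflexive (+-comm m 1)))
  where
  V-∪ : ∀ x → (⌊ x ≟ v ⌋ ∨ V Y x) ≡ V Y x
  V-∪ x with x ≟ v
  ... | yes refl = ≡-sym vv
  ... | no _ = refl
  shared≤1 : count (λ x → ⌊ x ≟ v ⌋ ∧ V Y x) ≤ 1
  shared≤1 = count≤1 _ v (λ x p → ≟-true⇒≡ (∧-elimˡ {⌊ x ≟ v ⌋} p))

restrict-drops : (G : Graph n) (S : Fin n → Bool) {x : Fin n} → S x ≡ false → V (restrict G S) x ≡ false
restrict-drops G S {x} p = trans (cong (V G x ∧_) p) (∧-zeroʳ (V G x))

rtd-disjoint : {Y : Graph n} {k : ℕ} → WF Y → (R : Fin n → Bool) → Closed Y R →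
  (∃ λ x → (V Y x ∧ R x) ≡ true) → (∃ λ y → (V Y y ∧ not (R y)) ≡ true) →
  RTD2≤ (restrict Y R) k →
  RTD2≤ (deleteSet (restrict Y (λ z → not (R z))) (V (restrict Y R))) k → RTD2≤ Y k
rtd-disjoint {Y = Y} {k} w R closed (x , px) (y , py) rA rB =
  split two (restrict Y R) (restrict Y (λ z → not (R z))) (restrict-⊆ R w) (restrict-⊆ _ w)
    (λ z → V-∪ (V Y z) (R z)) (λ a b → E-∪ (E Y a b) (R a) (R b) (R-edge a b)) (λ a b → E-∩ (E Y a b) (R a) (R b))
    (≤-trans (≤-reflexive no-shared) z≤n) (x , px)
    (y , ∧-intro py (≡false⇒not≡true (restrict-drops Y R (not≡true⇒≡false (∧-elimʳ {V Y y} py)))))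
    rA k rB (≤-reflexive (trans (cong (k +_) no-shared) (+-identityʳ k)))
  where
  V-∪ : ∀ a b → ((a ∧ b) ∨ (a ∧ not b)) ≡ a
  V-∪ false b = refl
  V-∪ true true = refl
  V-∪ true false = refl
  E-∪ : ∀ e a b → (e ≡ true → a ≡ b) → ((e ∧ (a ∧ b)) ∨ (e ∧ (not a ∧ not b))) ≡ e
  E-∪ false a b f = refl
  E-∪ true a b f with f refl
  E-∪ true true .true f | refl = refl
  E-∪ true false .false f | refl = refl
  E-∩ : ∀ e a b → ((e ∧ (a ∧ b)) ∧ (e ∧ (not a ∧ not b))) ≡ false
  E-∩ false a b = refl
  E-∩ true true b = ∧-zeroʳ b
  E-∩ true false b = refl
  V-∩ : ∀ a b → ((a ∧ b) ∧ (a ∧ not b)) ≡ false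
  V-∩ false b = refl
  V-∩ true true = refl
  V-∩ true false = refl
  no-shared : count (λ z → (V Y z ∧ R z) ∧ (V Y z ∧ not (R z))) ≡ 0
  no-shared = count-nowhere _ (λ z → V-∩ (V Y z) (R z))
  two : 2 ≤ count (V Y)
  two = count≥2 (V Y) x y (∧-elimˡ {V Y x} px) (∧-elimˡ {V Y y} py)
          λ { refl → ≡true⇒≢false (∧-elimʳ {V Y x} px) (not≡true⇒≡false (∧-elimʳ {V Y x} py)) }
  R-edge : ∀ a b → E Y a b ≡ true → R a ≡ R b
  R-edge a b e with true-or-false (R a) | true-or-false (R b)
  ... | inj₁ p | _ rewrite p = ≡-sym (closed a b p e)
  ... | inj₂ p | inj₁ q = ⊥-elim (≡true⇒≢false (closed b a q (edge-sym w e)) p)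
  ... | inj₂ p | inj₂ q = trans p (≡-sym q)

-- Y[R ∪ {u}] when u separates R from the rest of Y.
attach : Graph n → Fin n → (Fin n → Bool) → Graph n
attach Y u R = restrict Y (λ z → R z ∨ ⌊ z ≟ u ⌋)

-- Split Y into A = Y[¬R] and B = attach Y u R, sharing only u.
rtd-cut : {Y : Graph n} {k : ℕ} (m : ℕ) → WF Y → ∀ u (R : Fin n → Bool) → V Y u ≡ true → R u ≡ false →
  (∀ a b → E Y a b ≡ true → R a ≡ true → (R b ∨ ⌊ b ≟ u ⌋) ≡ true) →
  (∃ λ r → (V Y r ∧ R r) ≡ true) →
  RTD2≤ (restrict Y (λ z → not (R z))) k →
  RTD2≤ (deleteSet (attach Y u R) (V (restrict Y (λ z → not (R z))))) m → suc m ≤ k → RTD2≤ Y k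
rtd-cut {Y = Y} {k} m w u R vu ru closed (r , pr) rA rB m<k =
  split two (restrict Y (λ z → not (R z))) (attach Y u R) (restrict-⊆ _ w) (restrict-⊆ _ w)
    V-∪ E-∪ E-∩ shared≤1 (u , ∧-intro vu (≡false⇒not≡true ru))
    (r , ∧-intro (∧-intro (∧-elimˡ {V Y r} pr) (∨-introˡ (∧-elimʳ {V Y r} pr)))
                 (≡false⇒not≡true (restrict-drops Y (λ z → not (R z)) (cong not (∧-elimʳ {V Y r} pr)))))
    rA m rB (≤-trans (≤-trans (+-monoʳ-≤ m shared≤1) (≤-reflexive (+-comm m 1))) m<k)
  where
  two : 2 ≤ count (V Y)
  two = count≥2 (V Y) u r vu (∧-elimˡ {V Y r} pr) λ { refl → ≡true⇒≢false (∧-elimʳ {V Y u} pr) ru }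
  V-∪ : ∀ z → ((V Y z ∧ not (R z)) ∨ (V Y z ∧ (R z ∨ ⌊ z ≟ u ⌋))) ≡ V Y z
  V-∪ z with V Y z | R z
  ... | false | _ = refl
  ... | true | false = refl
  ... | true | true = refl
  E-∪ : ∀ a b → ((E Y a b ∧ (not (R a) ∧ not (R b))) ∨ (E Y a b ∧ ((R a ∨ ⌊ a ≟ u ⌋) ∧ (R b ∨ ⌊ b ≟ u ⌋)))) ≡ E Y a b
  E-∪ a b = covered (E Y a b) (R a) (R b) _ _ (closed a b) (λ e → closed b a (edge-sym w e))
    where
    covered : ∀ e a b c d → (e ≡ true → a ≡ true → (b ∨ d) ≡ true) → (e ≡ true → b ≡ true → (a ∨ c) ≡ true) →
              ((e ∧ (not a ∧ not b)) ∨ (e ∧ ((a ∨ c) ∧ (b ∨ d)))) ≡ e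
    covered false a b c d f g = refl
    covered true true b c d f g = f refl refl
    covered true false true c d f g rewrite g refl refl = refl
    covered true false false c d f g = refl
  E-∩ : ∀ a b → ((E Y a b ∧ (not (R a) ∧ not (R b))) ∧ (E Y a b ∧ ((R a ∨ ⌊ a ≟ u ⌋) ∧ (R b ∨ ⌊ b ≟ u ⌋)))) ≡ false
  E-∩ a b = disjoint (E Y a b) (R a) (R b) _ _ (λ e p q → edge-≢ w e (trans (≟-true⇒≡ p) (≡-sym (≟-true⇒≡ q))))
    where
    disjoint : ∀ e a b c d → (e ≡ true → c ≡ true → d ≡ true → ⊥) →
               ((e ∧ (not a ∧ not b)) ∧ (e ∧ ((a ∨ c) ∧ (b ∨ d)))) ≡ false
    disjoint false a b c d h = refl
    disjoint true true b c d h = refl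
    disjoint true false true c d h = refl
    disjoint true false false false d h = refl
    disjoint true false false true false h = refl
    disjoint true false false true true h = ⊥-elim (h refl refl refl)
  shared-u : ∀ x → ((V Y x ∧ not (R x)) ∧ (V Y x ∧ (R x ∨ ⌊ x ≟ u ⌋))) ≡ true → x ≡ u
  shared-u x p with true-or-false (R x)
  ... | inj₁ rx = ⊥-elim (≡true⇒≢false rx (not≡true⇒≡false (∧-elimʳ {V Y x} (∧-elimˡ {V Y x ∧ not (R x)} p))))
  ... | inj₂ rx = ≟-true⇒≡ (subst (λ b → (b ∨ ⌊ x ≟ u ⌋) ≡ true) rx (∧-elimʳ {V Y x} (∧-elimʳ {V Y x ∧ not (R x)} p)))
  shared≤1 : count (λ x → (V Y x ∧ not (R x)) ∧ (V Y x ∧ (R x ∨ ⌊ x ≟ u ⌋))) ≤ 1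
  shared≤1 = count≤1 _ u shared-u

-- Split off one vertex at a time as a component.
rtd-edgeless : ∀ N {Y : Graph n} → WF Y → (∀ x y → E Y x y ≡ false) → count (V Y) ≤ N → RTD2≤ Y 1
rtd-edgeless zero {Y = Y} w el c = null λ x → ≢true⇒≡false λ p → <-irrefl refl (≤-trans (count-pos (V Y) x p) c)
rtd-edgeless (suc N) {Y = Y} w el c with nonnull-or-null Y
... | inj₂ nl = null nl
... | inj₁ (x , vx) with count (V Y) ≤? 1
...   | yes c1 = single (≤-antisym c1 (count-pos (V Y) x vx))
...   | no c1 = rtd-disjoint w (λ z → ⌊ z ≟ x ⌋) (λ a b _ e → ⊥-elim (≡true⇒≢false e (el a b)))
               (x , ∧-intro vx (≟-diag x)) (count≥2⇒other (V Y) (≰⇒> c1) x)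
               (single (≤-antisym (count≤1 _ x (λ z p → ≟-true⇒≡ (∧-elimʳ {V Y z} p))) (count-pos _ x (∧-intro vx (≟-diag x)))))
               (rtd-edgeless N (wf-restrict _ (wf-restrict _ w)) (λ a b → cong (_∧ (not (V Y a ∧ ⌊ a ≟ x ⌋) ∧ not (V Y b ∧ ⌊ b ≟ x ⌋))) (cong (_∧ _) (el a b)))
                  (≤-pred (≤-trans (count-mono-< _ (V Y) (λ z p → ∧-elimˡ {V Y z} (∧-elimˡ {V Y z ∧ _} p)) x vx x-gone) c)))
  where
  x-gone : ((V Y x ∧ not ⌊ x ≟ x ⌋) ∧ not (V Y x ∧ ⌊ x ≟ x ⌋)) ≡ false
  x-gone = cong (_∧ not (V Y x ∧ ⌊ x ≟ x ⌋)) (delete-self Y x)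


record Pendant (Y : Graph n) (u : Fin n) (R : Fin n → Bool) : Set where
  field
    u∈Y    : V Y u ≡ true
    u∉R    : R u ≡ false
    R⊆Y    : ∀ z → R z ≡ true → V Y z ≡ true
    R≢∅    : ∃ λ r → R r ≡ true
    closed : ∀ a b → E Y a b ≡ true → R a ≡ true → (R b ∨ ⌊ b ≟ u ⌋) ≡ true
    linked : AllLinked (attach Y u R)

attach-∈R : {Y : Graph n} {u : Fin n} {R : Fin n → Bool} {z : Fin n} →
            V (attach Y u R) z ≡ true → ¬ z ≡ u → R z ≡ true
attach-∈R {Y = Y} {u} {R} {z} p z≢u with ∨-elim {R z} (∧-elimʳ {V Y z} p)
... | inj₁ r = r
... | inj₂ r = ⊥-elim (z≢u (≟-true⇒≡ r))

-- Every vertex of Y[R' ∪ {w}], for R' the component of c in Z − w, is joined to c;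
-- w itself through the last edge of a walk in Z from c to w.
attach-component-linked : {Y : Graph n} → WF Y → (S : Fin n → Bool) → AllLinked (restrict Y S) →
  ∀ w c → V (restrict Y S) w ≡ true → V (delete (restrict Y S) w) c ≡ true →
  AllLinked (attach Y w (reach (delete (restrict Y S) w) c))
attach-component-linked {n} {Y} wY S linked w c vw vc z₁ z₂ p₁ p₂ =
  walk-reverse wZ' (from-c z₁ p₁) ++ʷ from-c z₂ p₂
  where
  Z = restrict Y S
  W = delete Z w
  R' = reach W c
  wZ' = wf-restrict (λ z → R' z ∨ ⌊ z ≟ w ⌋) wY
  wW = wf-delete w (wf-restrict S wY)
  W→Y : ∀ z → V W z ≡ true → V Y z ≡ true
  W→Y z p = ∧-elimˡ {V Y z} (∧-elimˡ {V Y z ∧ S z} p)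
  EW→EY : ∀ a b → E W a b ≡ true → E Y a b ≡ true
  EW→EY a b p = ∧-elimˡ {E Y a b} (∧-elimˡ {E Y a b ∧ (S a ∧ S b)} p)
  w∉R' : R' w ≡ false
  w∉R' = ≢true⇒≡false λ q → ≡true⇒≢false (reach-vertex W wW c vc w q) (delete-self Z w)
  within-R' : ∀ z → R' z ≡ true → Walk (attach Y w R') c z
  within-R' z p = walk-map (λ x q → ∧-intro (W→Y x (∧-elimˡ {V W x} q)) (∨-introˡ (∧-elimʳ {V W x} q)))
                    (λ a b q → ∧-intro (EW→EY a b (∧-elimˡ {E W a b} q))
                                 (∧-intro (∨-introˡ (∧-elimˡ {R' a} (∧-elimʳ {E W a b} q)))
                                          (∨-introˡ (∧-elimʳ {R' a} (∧-elimʳ {E W a b} q)))))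
                    (walk-restrict R' (reach-closed W c) (reach-sound W wW c vc z p) (reach-self W c))
  edge-to-w : ∃ λ p → R' p ≡ true × E Y p w ≡ true
  edge-to-w with walk-leaves R' (linked c w (∧-elimˡ {V Z c} vc) vw) (reach-self W c) w∉R'
  ... | p , d , rp , rd , e with d ≟ w
  ...   | yes refl = p , rp , ∧-elimˡ {E Y p d} e
  ...   | no d≢w = ⊥-elim (≡true⇒≢false (reach-closed W c p d rp
            (∧-intro e (∧-intro (∧-elimʳ {V Z p} (reach-vertex W wW c vc p rp)) (≢⇒not-≟ d≢w)))) rd)
  from-c : ∀ z → V (attach Y w R') z ≡ true → Walk (attach Y w R') c z
  from-c z q with ∨-elim {R' z} (∧-elimʳ {V Y z} q)
  ... | inj₁ r = within-R' z r
  ... | inj₂ r with ≟-true⇒≡ r | edge-to-w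
  ...   | refl | p , rp , e = within-R' p rp ++ʷ step (∧-intro e (∧-intro (∨-introˡ rp) (∨-introʳ {R' z} (≟-diag z)))) (here q)

pendant-shrink : {Y : Graph n} → WF Y → ∀ {u R} → Pendant Y u R → ∀ w c →
  V (attach Y u R) w ≡ true → V (delete (attach Y u R) w) c ≡ true →
  reach (delete (attach Y u R) w) c u ≡ false →
  (∃ λ z → R z ≡ true × reach (delete (attach Y u R) w) c z ≡ false) →
  Pendant Y w (reach (delete (attach Y u R) w) c) × count (reach (delete (attach Y u R) w) c) < count R
pendant-shrink {n} {Y} wY {u} {R} P w c vw vc u∉R' (z , rz , z∉R') =
  record { u∈Y    = ∧-elimˡ {V Y w} vw
         ; u∉R    = ≢true⇒≡false λ q → ≡true⇒≢false (reach-vertex W wW c vc w q) (delete-self Z w)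
         ; R⊆Y    = λ z q → ∧-elimˡ {V Y z} (∧-elimˡ {V Z z} (reach-vertex W wW c vc z q))
         ; R≢∅    = c , reach-self W c
         ; closed = closed'
         ; linked = attach-component-linked wY S (Pendant.linked P) w c vw vc }
  , count-mono-< R' R R'⊆R z rz z∉R'
  where
  S = λ z → R z ∨ ⌊ z ≟ u ⌋
  Z = attach Y u R
  W = delete Z w
  R' = reach W c
  wW = wf-delete w (wf-restrict S wY)
  R'⊆R : ∀ a → R' a ≡ true → R a ≡ true
  R'⊆R a q = attach-∈R {Y = Y} {R = R} (∧-elimˡ {V Z a} (reach-vertex W wW c vc a q)) λ { refl → ≡true⇒≢false q u∉R' }
  closed' : ∀ a b → E Y a b ≡ true → R' a ≡ true → (R' b ∨ ⌊ b ≟ w ⌋) ≡ true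
  closed' a b e q with b ≟ w
  ... | yes _ = ∨-introʳ {R' b} refl
  ... | no b≢w = ∨-introˡ (reach-closed W c a b q
           (∧-intro (∧-intro e (∧-intro (∨-introˡ (R'⊆R a q)) (Pendant.closed P a b e (R'⊆R a q))))
                    (∧-intro (∧-elimʳ {V Z a} (reach-vertex W wW c vc a q)) (≢⇒not-≟ b≢w))))

-- Descend through cut vertices until attach Y u R has none: a leaf block hanging at u.
leaf-block : ∀ fuel {Y : Graph n} → WF Y → ∀ u R → Pendant Y u R → count R ≤ fuel →
             ∃ λ u' → ∃ λ R' → Pendant Y u' R' × NoCutConnected (attach Y u' R')
leaf-block zero wY u R P bound with Pendant.R≢∅ P
... | r , pr = ⊥-elim (<-irrefl refl (≤-trans (count-pos R r pr) bound))
leaf-block (suc f) {Y} wY u R P bound with no-cut-or-cut (attach Y u R) (wf-restrict (λ z → R z ∨ ⌊ z ≟ u ⌋) wY)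
... | inj₁ no-cut = u , R , P , ((u , u∈Z) , Pendant.linked P) , no-cut
  where
  u∈Z = ∧-intro (Pendant.u∈Y P) (∨-introʳ {R u} (≟-diag u))
... | inj₂ (w , vw , a , b , va , vb , a↛b) = descend (w ≟ u)
  where
  Z = attach Y u R
  W = delete Z w
  wW = wf-delete w (wf-restrict (λ z → R z ∨ ⌊ z ≟ u ⌋) wY)
  recurse : ∀ c → V W c ≡ true → reach W c u ≡ false → (∃ λ z → R z ≡ true × reach W c z ≡ false) →
            ∃ λ u' → ∃ λ R' → Pendant Y u' R' × NoCutConnected (attach Y u' R')
  recurse c vc u∉R' missing with pendant-shrink wY P w c vw vc u∉R' missing
  ... | P' , smaller = leaf-block f wY w (reach W c) P' (≤-pred (≤-trans smaller bound))
  w∉ : ∀ c → V W c ≡ true → reach W c w ≡ false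
  w∉ c vc = ≢true⇒≡false λ q → ≡true⇒≢false (reach-vertex W wW c vc w q) (delete-self Z w)
  u↛ : ∀ c → V W c ≡ true → ¬ Walk W c u → reach W c u ≡ false
  u↛ c vc c↛u = ≢true⇒≡false λ q → c↛u (reach-sound W wW c vc u q)
  descend : Dec (w ≡ u) → ∃ λ u' → ∃ λ R' → Pendant Y u' R' × NoCutConnected (attach Y u' R')
  descend (yes refl) = recurse a va (w∉ a va)
    (b , attach-∈R {Y = Y} {R = R} (∧-elimˡ {V Z b} vb) (not-≟⇒≢ (∧-elimʳ {V Z b} vb)) ,
         ≢true⇒≡false λ q → a↛b (reach-sound W wW a va b q))
  descend (no w≢u) with walk? W wW u u∈W a | walk? W wW u u∈W b
    where
    u∈W = ∧-intro (∧-intro (Pendant.u∈Y P) (∨-introʳ {R u} (≟-diag u))) (≢⇒not-≟ λ e → w≢u (≡-sym e))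
  ... | yes u→a | yes u→b = ⊥-elim (a↛b (walk-reverse wW u→a ++ʷ u→b))
  ... | no u↛a | _ = recurse a va (u↛ a va λ a→u → u↛a (walk-reverse wW a→u))
                       (w , attach-∈R {Y = Y} {R = R} vw w≢u , w∉ a va)
  ... | yes _ | no u↛b = recurse b vb (u↛ b vb λ b→u → u↛b (walk-reverse wW b→u))
                           (w , attach-∈R {Y = Y} {R = R} vw w≢u , w∉ b vb)


RtdBound : {n : ℕ} → ℕ → Set
RtdBound {n} N = ∀ {Y : Graph n} j → WF Y → count (V Y) ≤ N → NoCutTD2≤ Y (2 + j) → RTD2≤ Y (2 + (j + j))

count-proper : {Y H : Graph n} {N : ℕ} → Subgraph H Y → ∀ z → V Y z ≡ true → V H z ≡ false →
               count (V Y) ≤ suc N → count (V H) ≤ N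
count-proper s z p q c = ≤-pred (≤-trans (count-mono-< _ _ (subV s) z p q) c)

rtd-odd : {N : ℕ} → RtdBound {n} N → ∀ j {B : Graph n} → WF B → count (V B) ≤ N →
          NoCutTD2≤ B (1 + j) → RTD2≤ B (1 + (j + j))
rtd-odd {N = N} IH zero wB c q = rtd-edgeless N wB (noCutTD1⇒edgeless wB q) c
rtd-odd IH (suc j) wB c q = rtd-≤ (s≤s (s≤s (+-monoʳ-≤ j (n≤1+n j)))) (IH j wB c q)

oneblock-td-inv : {Z : Graph n} {k : ℕ} → OneBlock Z → (∃ λ x → V Z x ≡ true) → TD2≤ Z (suc k) →
                  ∃ λ w → V Z w ≡ true × TD2≤ (delete Z w) k
oneblock-td-inv ob (x , p) (null q) = ⊥-elim (≡true⇒≢false p (q x))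
oneblock-td-inv ob ne (one _ w vw d) = w , vw , d
oneblock-td-inv ob ne (many _ nob _) = ⊥-elim (nob ob)

module UpperBoundStep {N : ℕ} (IH : RtdBound {n} N) (j : ℕ) {Y : Graph n} (wY : WF Y)
                      (bound : count (V Y) ≤ suc N) (tdY : NoCutTD2≤ Y (2 + j)) where

  on-proper : {H : Graph n} → Subgraph H Y → ∀ z → V Y z ≡ true → V H z ≡ false → RTD2≤ H (2 + (j + j))
  on-proper s z p q = IH j (wf s) (count-proper s z p q bound) (noCutTD-⊆ tdY s)

  rtd-unlinked : Unlinked Y → RTD2≤ Y (2 + (j + j))
  rtd-unlinked (x , y , vx , vy , x↛y) =
    rtd-disjoint wY R (reach-closed Y x) (x , ∧-intro vx (reach-self Y x)) (y , ∧-intro vy (≡false⇒not≡true y∉R))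
      (on-proper (restrict-⊆ R wY) y vy (restrict-drops Y R y∉R))
      (on-proper (⊆-trans (restrict-⊆ _ (wf-restrict _ wY)) (restrict-⊆ _ wY)) x vx
        (restrict-drops (restrict Y (λ z → not (R z))) (λ z → not (V Y z ∧ R z)) (cong not (∧-intro vx (reach-self Y x)))))
    where
    R = reach Y x
    y∉R : R y ≡ false
    y∉R = ≢true⇒≡false λ p → x↛y (reach-sound Y wY x vx y p)

  module _ {u : Fin n} {R : Fin n → Bool} (P : Pendant Y u R) (nc : NoCutConnected (attach Y u R)) where
    private
      Z = attach Y u R
      wZ = wf-restrict (λ z → R z ∨ ⌊ z ≟ u ⌋) wY
      B = deleteSet Z (V (restrict Y (λ z → not (R z))))
      wB = wf-restrict (λ z → not (V (restrict Y (λ z → not (R z))) z)) wZ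
      B⊆Z = restrict-⊆ (λ z → not (V (restrict Y (λ z → not (R z))) z)) wZ

    B⊆R : ∀ z → V B z ≡ true → R z ≡ true
    B⊆R z p with true-or-false (R z)
    ... | inj₁ r = r
    ... | inj₂ r = ⊥-elim (≡true⇒≢false (∧-elimʳ {V Z z} p)
                    (cong not (∧-intro (∧-elimˡ {V Y z} (∧-elimˡ {V Z z} p)) (≡false⇒not≡true r))))

    u∉B : V B u ≡ false
    u∉B = ≢true⇒≡false λ p → ≡true⇒≢false (B⊆R u p) (Pendant.u∉R P)

    u∈Z : V Z u ≡ true
    u∈Z = ∧-intro (Pendant.u∈Y P) (∨-introʳ {R u} (≟-diag u))

    B-proper : {H : Graph n} → Subgraph H B → count (V H) ≤ N
    B-proper s = count-proper (⊆-trans s (⊆-trans B⊆Z (restrict-⊆ _ wY))) u (Pendant.u∈Y P)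
                   (≢true⇒≡false λ p → ≡true⇒≢false (subV s u p) u∉B) bound

    -- Z − w is connected and edgeless containing u, so B − w (which misses u) is empty.
    remainder-null : ∀ w → V Z w ≡ true → TD2≤ (delete Z w) 1 → ¬ w ≡ u → IsNull (delete B w)
    remainder-null w vw d w≢u o = ≢true⇒≡false λ p →
      ≡true⇒≢false (subst (λ t → V B t ≡ true) (≡-sym (u≡o p)) (∧-elimˡ {V B o} p)) u∉B
      where
      edgeless = noCutTD1⇒edgeless (wf-delete w wZ) (td⇒noCutTD d)
      u≡o : V (delete B w) o ≡ true → u ≡ o
      u≡o p = walk-edgeless edgeless (proj₂ nc w vw u o (∧-intro u∈Z (≢⇒not-≟ λ e → w≢u (≡-sym e)))
                (∧-intro (subV B⊆Z o (∧-elimˡ {V B o} p)) (∧-elimʳ {V B o} p)))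

    rtd-leaf-remainder-at : ∀ w → V Z w ≡ true → TD2≤ (delete Z w) (1 + j) → Dec (w ≡ u) → RTD2≤ B (1 + (j + j))
    rtd-leaf-remainder-at w vw d (yes refl) =
      rtd-odd IH j wB (B-proper (⊆-refl wB)) (noCutTD-⊆ (td⇒noCutTD d) (⊆-delete w B⊆Z u∉B))
    rtd-leaf-remainder-at w vw d (no w≢u) = rtd-delete wB w∈B (remainder j d)
      where
      w∈B : V B w ≡ true
      w∈B = ∧-intro vw (≡false⇒not≡true (restrict-drops Y (λ z → not (R z)) (cong not (attach-∈R {Y = Y} {R = R} vw w≢u))))
      remainder : ∀ j → TD2≤ (delete Z w) (suc j) → RTD2≤ (delete B w) (j + j)
      remainder zero d = null (remainder-null w vw d w≢u)
      remainder (suc j) d = rtd-≤ (≤-reflexive (cong suc (≡-sym (+-suc j j))))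
        (IH j (wf-delete w wB) (B-proper (restrict-⊆ _ wB)) (noCutTD-⊆ (td⇒noCutTD d) (delete-mono w B⊆Z)))

    rtd-leaf-remainder : RTD2≤ B (1 + (j + j))
    rtd-leaf-remainder with oneblock-td-inv (nocut⇒oneblock wZ nc) (u , u∈Z) (tdY Z (restrict-⊆ _ wY) nc)
    ... | w , vw , d = rtd-leaf-remainder-at w vw d (w ≟ u)

  initial-pendant : ∀ x → V Y x ≡ true → 2 ≤ count (V Y) → AllLinked Y → Pendant Y x (λ z → V Y z ∧ not ⌊ z ≟ x ⌋)
  initial-pendant x vx two linked = record
    { u∈Y    = vx
    ; u∉R    = delete-self Y x
    ; R⊆Y    = λ z → ∧-elimˡ {V Y z}
    ; R≢∅    = count≥2⇒other (V Y) two x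
    ; closed = λ a b e _ → in-R∪x b (edge-endʳ wY e)
    ; linked = λ a b va vb → walk-map (λ z p → ∧-intro p (in-R∪x z p))
                 (λ a' b' e → ∧-intro e (∧-intro (in-R∪x a' (ends wY a' b' e)) (in-R∪x b' (edge-endʳ wY e))))
                 (linked a b (∧-elimˡ {V Y a} va) (∧-elimˡ {V Y b} vb)) }
    where
    in-R∪x : ∀ z → V Y z ≡ true → ((V Y z ∧ not ⌊ z ≟ x ⌋) ∨ ⌊ z ≟ x ⌋) ≡ true
    in-R∪x z p with z ≟ x
    ... | yes _ = ∨-introʳ {V Y z ∧ false} refl
    ... | no _ = ∨-introˡ (∧-intro p refl)

  -- Split Y at the attachment vertex of a leaf block.
  rtd-linked : ∀ x → V Y x ≡ true → 2 ≤ count (V Y) → AllLinked Y → RTD2≤ Y (2 + (j + j))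
  rtd-linked x vx two linked with leaf-block n wY x _ (initial-pendant x vx two linked) (count≤n _)
  ... | u , R , P , nc =
    rtd-cut (1 + (j + j)) wY u R (Pendant.u∈Y P) (Pendant.u∉R P) (Pendant.closed P) (r , ∧-intro r∈Y r∈R)
      (on-proper (restrict-⊆ _ wY) r r∈Y (restrict-drops Y (λ z → not (R z)) (cong not r∈R)))
      (rtd-leaf-remainder P nc) ≤-refl
    where
    r = proj₁ (Pendant.R≢∅ P)
    r∈R = proj₂ (Pendant.R≢∅ P)
    r∈Y = Pendant.R⊆Y P r r∈R

rtd-bound : ∀ N → RtdBound {n} N
rtd-bound zero {Y} j wY c tdY = null λ x → ≢true⇒≡false λ p → <-irrefl refl (≤-trans (count-pos (V Y) x p) c)
rtd-bound (suc N) {Y} j wY c tdY with nonnull-or-null Y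
... | inj₂ nl = null nl
... | inj₁ (x , vx) with count (V Y) ≤? 1
...   | yes c1 = single (≤-antisym c1 (count-pos (V Y) x vx))
...   | no c1 with linked-or-unlinked Y wY
...     | inj₂ unlinked = rtd-unlinked unlinked
  where open UpperBoundStep (rtd-bound N) j wY c tdY
...     | inj₁ linked = rtd-linked x vx (≰⇒> c1) linked
  where open UpperBoundStep (rtd-bound N) j wY c tdY

2*[2+j]∸2 : ∀ j → 2 * (2 + j) ∸ 2 ≡ 2 + (j + j)
2*[2+j]∸2 j = trans (+-suc j (suc (j + 0))) (cong suc (trans (+-suc j (j + 0)) (cong (λ t → suc (j + t)) (+-identityʳ j))))

lemma25 : ∀ {n} (G : Graph n) → WF G → HasEdge G →
          (∀ k → RTD2≤ G k → TD2≤ G k) × (∀ k → TD2≤ G k → RTD2≤ G (2 * k ∸ 2))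
lemma25 {n} G w (x , y , e) = (λ _ → rtd⇒td w) , upper
  where
  td>1 : ¬ TD2≤ G 1
  td>1 d = ≡true⇒≢false e (noCutTD1⇒edgeless w (td⇒noCutTD d) x y)
  upper : ∀ k → TD2≤ G k → RTD2≤ G (2 * k ∸ 2)
  upper zero d = ⊥-elim (td>1 (td-suc d))
  upper (suc zero) d = ⊥-elim (td>1 d)
  upper (suc (suc j)) d = subst (RTD2≤ G) (≡-sym (2*[2+j]∸2 j)) (rtd-bound n j w (count≤n (V G)) (td⇒noCutTD d))
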